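{- Let $x_0, x_1, x_2, \ldots$ be parameters (formal variables, or complex numbers) with $x_0 \neq 0$, and let $x(t) = \sum_{n\ge 0} x_n \frac{t^n}{n!}$. For $n \geq 1$ let \[ p_n = \sum_{T} \prod_{v \in V(T)} x_{\deg^+_T(v)}, \] the sum over all increasing trees $T$ on $n$ vertices, where $\deg^+_T(v)$ is the number of children of $v$ in $T$. For $s \geq 0$ define \[ b_s = \frac{1}{x_0} \sum_{k=0}^{s} \frac{k!}{(-x_0)^k}\, B_{s,k}(x_1, x_2, \ldots, x_{s-k+1}). \] Then for every $n \geq 1$, \[ p_n = x_0^{\,n} \sum_{k=0}^{n} (-x_0)^k\, B_{n+k-1,k}(0, b_1, b_2, \ldots, b_{n-1}). \]
   Context: An increasing tree on $n$ vertices is a rooted tree whose vertex set is $\{1,\ldots,n\}$ (children of a vertex are unordered) such that labels strictly increase along every path from the root to a leaf. Equivalently, $P(t)=\sum_{n\ge1} p_n \frac{t^n}{n!}$ is the degree-sequence generating function of increasing trees, satisfying $P'(t) = x(P(t))$, $P(0)=0$. Bell polynomials: for integers $n,k \geq 0$, $B_{n,k}(y_1,y_2,\ldots,y_{n-k+1}) = \sum_{\alpha} \frac{n!}{\alpha_1!\cdots\alpha_{n-k+1}!}\prod_{i}\left(\frac{y_i}{i!}\right)^{\alpha_i}$, the sum over all sequences $\alpha$ of nonnegative integers with $\sum_i \alpha_i = k$ and $\sum_i i\,\alpha_i = n$; in particular $B_{0,0}=1$ and $B_{n,0}=0$ for $n\ge1$. Extra arguments beyond those needed are ignored. -}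

module Defs where

open import Algebra.Bundles using (CommutativeRing)
open import Data.Nat using (ℕ; zero; suc; _+_; _*_; _∸_; _/_)
open import Data.Nat using (_!)
open import Data.Nat.Properties using (_≟_)
open import Data.Fin using (Fin; toℕ)
open import Data.List using (List; []; _∷_; map; concatMap; upTo; allFin; filter; foldr)
open import Data.Vec using (Vec; []; _∷_)
open import Data.Product using (_×_; _,_)
open import Relation.Nullary using (yes; no)
open import Relation.Nullary.Decidable using (_×-dec_)

-- An increasing tree on n vertices has vertex set {1,…,n}; we encode
-- vertex i+1 by the natural number i (so vertices are 0,…,n-1, root 0).
-- Since labels increase away from the root, the largest vertex is a leaf;
-- removing it gives an increasing tree on one vertex fewer, and the tree
-- is recovered by recording the parent of the largest vertex, which may
-- be any smaller vertex.  Hence increasing trees on n vertices are in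
-- exact correspondence with the following inductive family.

data IncTree : ℕ → Set where
  single : IncTree 1
  -- attach t p : add a new largest vertex as a child of vertex p
  attach : ∀ {n} → IncTree (suc n) → Fin (suc n) → IncTree (suc (suc n))

allTrees : (n : ℕ) → List (IncTree n)
allTrees zero = []
allTrees (suc zero) = single ∷ []
allTrees (suc (suc n)) =
  concatMap (λ t → map (attach t) (allFin (suc n))) (allTrees (suc n))

outdeg : ∀ {n} → IncTree n → ℕ → ℕ
outdeg single v = 0
outdeg (attach t p) v with toℕ p ≟ v
... | yes _ = suc (outdeg t v)
... | no  _ = outdeg t v

allVecs : (m b : ℕ) → List (Vec ℕ m)
allVecs zero b = [] ∷ []
allVecs (suc m) b = concatMap (λ a → map (a ∷_) (allVecs m b)) (upTo (suc b))

sumV : ∀ {m} → Vec ℕ m → ℕ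
sumV [] = 0
sumV (a ∷ as) = a + sumV as

wsumV : ∀ {m} → ℕ → Vec ℕ m → ℕ
wsumV i [] = 0
wsumV i (a ∷ as) = i * a + wsumV (suc i) as

denomV : ∀ {m} → ℕ → Vec ℕ m → ℕ
denomV i [] = 1
denomV i (a ∷ as) = (a !) * ((i !) Data.Nat.^ a) * denomV (suc i) as

-- exact division (the denominator is never 0; the 0 case is a dummy)
_div_ : ℕ → ℕ → ℕ
a div zero = 0
a div (suc d) = a / suc d

-- the index set of B_{n,k}: α ∈ ℕ^{n-k+1} with Σ αᵢ = k, Σ i αᵢ = n
-- (entries are bounded by n + k, which loses nothing)
bellIndex : (n k : ℕ) → List (Vec ℕ (suc (n ∸ k)))
bellIndex n k =
  filter (λ α → (sumV α ≟ k) ×-dec (wsumV 1 α ≟ n)) (allVecs (suc (n ∸ k)) (n + k))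

module Ops {c ℓ} (R : CommutativeRing c ℓ) where
  open CommutativeRing R renaming (_+_ to _+ᴿ_; _*_ to _*ᴿ_)

  _·_ : ℕ → Carrier → Carrier
  zero · r = 0#
  suc n · r = r +ᴿ (n · r)

  _^_ : Carrier → ℕ → Carrier
  r ^ zero = 1#
  r ^ suc n = r *ᴿ (r ^ n)

  sumR : List Carrier → Carrier
  sumR = foldr _+ᴿ_ 0#

  prodR : List Carrier → Carrier
  prodR = foldr _*ᴿ_ 1#

  Σ≤ : ℕ → (ℕ → Carrier) → Carrier
  Σ≤ n f = sumR (map f (upTo (suc n)))

  monoV : ∀ {m} → (ℕ → Carrier) → ℕ → Vec ℕ m → Carrier
  monoV y i [] = 1#
  monoV y i (a ∷ as) = (y i ^ a) *ᴿ monoV y (suc i) as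

  -- Bell polynomial B_{n,k}(y₁, y₂, …, y_{n-k+1}); the argument list is
  -- given as a function y with y i = yᵢ (y 0 is never used)
  B : (n k : ℕ) → (ℕ → Carrier) → Carrier
  B n k y = sumR (map (λ α → ((n !) div denomV 1 α) · monoV y 1 α) (bellIndex n k))

  p : (ℕ → Carrier) → ℕ → Carrier
  p x n = sumR (map (λ T → prodR (map (λ v → x (outdeg T v)) (upTo n))) (allTrees n))

  b : (ℕ → Carrier) → (x₀⁻¹ : Carrier) → ℕ → Carrier
  b x x₀⁻¹ s = x₀⁻¹ *ᴿ Σ≤ s (λ k → ((k !) · ((- x₀⁻¹) ^ k)) *ᴿ B s k x)

  -- argument list (0, b₁, b₂, …):  y₁ = 0, y_{j+1} = b_j
  shiftArgs : (ℕ → Carrier) → ℕ → Carrier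
  shiftArgs bs zero = 0#
  shiftArgs bs (suc zero) = 0#
  shiftArgs bs (suc (suc j)) = bs (suc j)

-- Work with exponential generating functions Σ fₙ tⁿ/n! over R.  Deleting the largest vertex of an
-- increasing tree shows that the weights ∏ᵥ x^(deg v) of the trees on k + 1 vertices add up to Dᵏ x,
-- where D H = x · H′; hence p_{k+1} = (Dᵏ x)(0).  The Bell polynomial B_{n,k}(y) is the n-th coefficient
-- of Yᵏ/k! for Y = Σ_{i≥1} yᵢ tⁱ/i!, so b is the expansion of 1/x = x₀⁻¹ Σₖ (−(x − x₀)/x₀)ᵏ.  Let β be
-- the series with β(0) = 0 and β′ = 1/x − 1/x₀.  Writing 1/x = x₀⁻¹ + β′, an induction on m gives
-- (Dᵐ⁺¹ H)(0) = x₀ᵐ⁺¹ Σₖ (−x₀)ᵏ [tᵐ⁺ᵏ/(m+k)!] (βᵏ/k!) H′, the sum telescoping at each step.  For H = t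
-- this is the theorem, since B_{m+k,k}(0, b₁, b₂, …) is the coefficient of tᵐ⁺ᵏ/(m+k)! in βᵏ/k!.
module Submission where

open import Defs
open import Algebra.Bundles using (CommutativeRing)
open import Data.Nat using (ℕ)

module IntegerSolver {a ℓ} (R : CommutativeRing a ℓ) where
  open import Data.Integer as ℤ using (ℤ; +_; -[1+_]; _⊖_; _◃_)
  import Data.Integer.Properties as ℤ
  open import Data.Maybe using (Maybe; just; nothing)
  open import Data.Nat as ℕ using (ℕ; zero; suc)
  import Data.Nat.Properties as ℕ
  open import Data.Sign as Sign using (Sign)
  open import Relation.Binary.PropositionalEquality as ≡ using (_≡_)
  open import Relation.Nullary using (yes; no)
  import Algebra.Solver.Ring
  import Algebra.Solver.Ring.AlmostCommutativeRing as ACR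
  import Algebra.Properties.Ring as RingProperties
  import Algebra.Properties.Semiring.Mult as SemiringMult
  open CommutativeRing R
  open SemiringMult semiring using (_×_; ×-homo-+; ×1-homo-*)
  open RingProperties ring using (-‿involutive; -‿distribˡ-*; -‿distribʳ-*; -‿+-comm; -0#≈0#)
  open import Relation.Binary.Reasoning.Setoid setoid

  ⟦_⟧ℤ : ℤ → Carrier
  ⟦ + n ⟧ℤ = n × 1#
  ⟦ -[1+ n ] ⟧ℤ = - (suc n × 1#)

  signed : Sign → Carrier → Carrier
  signed Sign.+ r = r
  signed Sign.- r = - r

  signed-cong : ∀ s {r r′} → r ≈ r′ → signed s r ≈ signed s r′
  signed-cong Sign.+ r≈r′ = r≈r′
  signed-cong Sign.- r≈r′ = -‿cong r≈r′

  signed-* : ∀ s t r r′ → signed (s Sign.* t) (r * r′) ≈ signed s r * signed t r′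
  signed-* Sign.+ Sign.+ r r′ = refl
  signed-* Sign.+ Sign.- r r′ = -‿distribʳ-* r r′
  signed-* Sign.- Sign.+ r r′ = -‿distribˡ-* r r′
  signed-* Sign.- Sign.- r r′ = begin
    r * r′           ≈⟨ -‿involutive (r * r′) ⟨
    - (- (r * r′))   ≈⟨ -‿cong (-‿distribˡ-* r r′) ⟩
    - ((- r) * r′)   ≈⟨ -‿distribʳ-* (- r) r′ ⟩
    (- r) * (- r′)   ∎

  ⟦◃⟧ : ∀ s n → ⟦ s ◃ n ⟧ℤ ≈ signed s (n × 1#)
  ⟦◃⟧ Sign.+ zero = refl
  ⟦◃⟧ Sign.- zero = sym -0#≈0#
  ⟦◃⟧ Sign.+ (suc n) = refl
  ⟦◃⟧ Sign.- (suc n) = refl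

  ⟦sign◃abs⟧ : ∀ i → ⟦ i ⟧ℤ ≈ signed (ℤ.sign i) (ℤ.∣ i ∣ × 1#)
  ⟦sign◃abs⟧ (+ n) = refl
  ⟦sign◃abs⟧ -[1+ n ] = refl

  ⟦*⟧ : ∀ i j → ⟦ i ℤ.* j ⟧ℤ ≈ ⟦ i ⟧ℤ * ⟦ j ⟧ℤ
  ⟦*⟧ i j = begin
    ⟦ s ◃ (∣i∣ ℕ.* ∣j∣) ⟧ℤ                   ≈⟨ ⟦◃⟧ s (∣i∣ ℕ.* ∣j∣) ⟩
    signed s ((∣i∣ ℕ.* ∣j∣) × 1#)            ≈⟨ signed-cong s (×1-homo-* ∣i∣ ∣j∣) ⟩
    signed s ((∣i∣ × 1#) * (∣j∣ × 1#))       ≈⟨ signed-* (ℤ.sign i) (ℤ.sign j) _ _ ⟩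
    signed (ℤ.sign i) (∣i∣ × 1#) * signed (ℤ.sign j) (∣j∣ × 1#)
                                             ≈⟨ *-cong (⟦sign◃abs⟧ i) (⟦sign◃abs⟧ j) ⟨
    ⟦ i ⟧ℤ * ⟦ j ⟧ℤ                          ∎
    where
    s = ℤ.sign i Sign.* ℤ.sign j
    ∣i∣ = ℤ.∣ i ∣
    ∣j∣ = ℤ.∣ j ∣

  1+-cancel-− : ∀ r r′ → r - r′ ≈ (1# + r) - (1# + r′)
  1+-cancel-− r r′ = begin
    r - r′                      ≈⟨ +-identityˡ _ ⟨
    0# + (r - r′)               ≈⟨ +-congʳ (-‿inverseʳ 1#) ⟨
    (1# - 1#) + (r - r′)        ≈⟨ +-assoc 1# (- 1#) (r - r′) ⟩
    1# + (- 1# + (r - r′))      ≈⟨ +-congˡ (+-assoc (- 1#) r (- r′)) ⟨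
    1# + ((- 1# + r) - r′)      ≈⟨ +-congˡ (+-congʳ (+-comm (- 1#) r)) ⟩
    1# + ((r - 1#) - r′)        ≈⟨ +-congˡ (+-assoc r (- 1#) (- r′)) ⟩
    1# + (r + (- 1# - r′))      ≈⟨ +-congˡ (+-congˡ (-‿+-comm 1# r′)) ⟩
    1# + (r - (1# + r′))        ≈⟨ +-assoc 1# r _ ⟨
    (1# + r) - (1# + r′)        ∎

  ⟦⊖⟧ : ∀ m n → ⟦ m ⊖ n ⟧ℤ ≈ (m × 1#) - (n × 1#)
  ⟦⊖⟧ zero zero = sym (-‿inverseʳ 0#)
  ⟦⊖⟧ zero (suc n) = sym (+-identityˡ _)
  ⟦⊖⟧ (suc m) zero = sym (trans (+-congˡ -0#≈0#) (+-identityʳ _))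
  ⟦⊖⟧ (suc m) (suc n) = begin
    ⟦ suc m ⊖ suc n ⟧ℤ      ≡⟨ ≡.cong ⟦_⟧ℤ (ℤ.[1+m]⊖[1+n]≡m⊖n m n) ⟩
    ⟦ m ⊖ n ⟧ℤ              ≈⟨ ⟦⊖⟧ m n ⟩
    (m × 1#) - (n × 1#)     ≈⟨ 1+-cancel-− (m × 1#) (n × 1#) ⟩
    (1# + m × 1#) - (1# + n × 1#) ∎

  ⟦+⟧ : ∀ i j → ⟦ i ℤ.+ j ⟧ℤ ≈ ⟦ i ⟧ℤ + ⟦ j ⟧ℤ
  ⟦+⟧ (+ m) (+ n) = ×-homo-+ 1# m n
  ⟦+⟧ (+ m) -[1+ n ] = ⟦⊖⟧ m (suc n)
  ⟦+⟧ -[1+ m ] (+ n) = trans (⟦⊖⟧ n (suc m)) (+-comm _ _)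
  ⟦+⟧ -[1+ m ] -[1+ n ] = begin
    - (suc (suc (m ℕ.+ n)) × 1#)       ≡⟨ ≡.cong (λ k → - (k × 1#)) (ℕ.+-suc (suc m) n) ⟨
    - ((suc m ℕ.+ suc n) × 1#)         ≈⟨ -‿cong (×-homo-+ 1# (suc m) (suc n)) ⟩
    - ((suc m × 1#) + (suc n × 1#))    ≈⟨ -‿+-comm _ _ ⟨
    ⟦ -[1+ m ] ⟧ℤ + ⟦ -[1+ n ] ⟧ℤ      ∎

  ⟦-⟧ : ∀ i → ⟦ ℤ.- i ⟧ℤ ≈ - ⟦ i ⟧ℤ
  ⟦-⟧ -[1+ n ] = sym (-‿involutive _)
  ⟦-⟧ (+ zero) = sym -0#≈0#
  ⟦-⟧ (+ suc n) = refl

  ⟦⟧-homomorphism : CommutativeRing.rawRing ℤ.+-*-commutativeRing ACR.-Raw-AlmostCommutative⟶ ACR.fromCommutativeRing R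
  ⟦⟧-homomorphism = record
    { ⟦_⟧ = ⟦_⟧ℤ ; +-homo = ⟦+⟧ ; *-homo = ⟦*⟧ ; -‿homo = ⟦-⟧
    ; 0-homo = refl ; 1-homo = +-identityʳ 1# }

  ⟦⟧-≟ : ∀ i j → Maybe (⟦ i ⟧ℤ ≈ ⟦ j ⟧ℤ)
  ⟦⟧-≟ i j with i ℤ.≟ j
  ... | yes i≡j = just (reflexive (≡.cong ⟦_⟧ℤ i≡j))
  ... | no _ = nothing

  open Algebra.Solver.Ring _ (ACR.fromCommutativeRing R) ⟦⟧-homomorphism ⟦⟧-≟ public
    using (solve; _:+_; _:*_; :-_; _:-_; _:=_)


module Combinatorics where
  open import Data.Nat using (ℕ; zero; suc; _+_; _*_; _∸_; _^_; _!; s≤s; NonZero)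
  open import Data.Nat.Properties
    using (_!≢0; _!*_!≢0; m*n≢0; m^n≢0; m≤m+n; m+n∸m≡n; m+[n∸m]≡n; *-assoc; *-cancelʳ-≡; *-cancelˡ-≡; ≤-<-connex; *-suc; *-zeroʳ)
  open import Data.Nat.Combinatorics using (_C_; nCk≡n!/k![n-k]!; k>n⇒nCk≡0; k![n∸k]!∣n!)
  open import Data.Nat.DivMod using (_/_; m/n*n≡m; m*n/n≡m)
  open import Data.Nat.Tactic.RingSolver using (solve-∀)
  open import Data.Sum using (inj₁; inj₂)
  open import Data.Vec using (Vec; []; _∷_)
  open import Relation.Binary.PropositionalEquality using (_≡_; refl; cong; cong₂; subst; module ≡-Reasoning)

  C-factorial : ∀ m w → ((m + w) C m) * (m ! * w !) ≡ (m + w) !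
  C-factorial m w = begin
    ((m + w) C m) * (m ! * w !)               ≡⟨ cong (λ d → ((m + w) C m) * (m ! * d !)) (m+n∸m≡n m w) ⟨
    ((m + w) C m) * (m ! * (m + w ∸ m) !)     ≡⟨ cong (_* (m ! * (m + w ∸ m) !)) (nCk≡n!/k![n-k]! (m≤m+n m w)) ⟩
    (m + w) ! / (m ! * (m + w ∸ m) !) * (m ! * (m + w ∸ m) !) ≡⟨ m/n*n≡m (k![n∸k]!∣n! (m≤m+n m w)) ⟩
    (m + w) !                               ∎
    where
    open ≡-Reasoning
    instance _ = m !* (m + w ∸ m) !≢0

  C-absorption : ∀ n k → suc k * (suc n C suc k) ≡ suc n * (n C k)
  C-absorption n k with ≤-<-connex k n
  ... | inj₂ n<k rewrite k>n⇒nCk≡0 (s≤s n<k) | k>n⇒nCk≡0 n<k | *-zeroʳ k | *-zeroʳ n = refl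
  ... | inj₁ k≤n = subst (λ n → suc k * (suc n C suc k) ≡ suc n * (n C k)) (m+[n∸m]≡n k≤n)
                         (*-cancelʳ-≡ _ _ (k ! * w !) {{k !* w !≢0}} cleared)
    where
    open ≡-Reasoning
    w = n ∸ k
    cleared : suc k * (suc (k + w) C suc k) * (k ! * w !) ≡ suc (k + w) * ((k + w) C k) * (k ! * w !)
    cleared = begin
      suc k * (suc (k + w) C suc k) * (k ! * w !)   ≡⟨ regroup k (suc (k + w) C suc k) (k !) (w !) ⟩
      ((suc k + w) C suc k) * (suc k ! * w !)        ≡⟨ C-factorial (suc k) w ⟩
      suc (k + w) * (k + w) !                      ≡⟨ cong (suc (k + w) *_) (C-factorial k w) ⟨
      suc (k + w) * (((k + w) C k) * (k ! * w !))    ≡⟨ *-assoc (suc (k + w)) ((k + w) C k) (k ! * w !) ⟨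
      suc (k + w) * ((k + w) C k) * (k ! * w !)    ∎
      where
      regroup : ∀ k c x y → suc k * c * (x * y) ≡ c * ((suc k * x) * y)
      regroup = solve-∀

  -- The number of partitions of a set of suc i * a elements into blocks of size suc i;
  -- the recursion chooses the block of the least element first.
  equipartitions : ℕ → ℕ → ℕ
  equipartitions i zero = 1
  equipartitions i (suc a) = ((i + suc i * a) C i) * equipartitions i a

  equipartitions-factorial : ∀ i a → (suc i * a) ! ≡ equipartitions i a * (a ! * (suc i !) ^ a)
  equipartitions-factorial i zero rewrite *-zeroʳ i = refl
  equipartitions-factorial i (suc a) = begin
    (s * suc a) !                              ≡⟨ cong _! (*-suc s a) ⟩
    (s + N) !                                  ≡⟨ C-factorial s N ⟨
    ((s + N) C s) * (s ! * N !)                ≡⟨ cong₂ (λ c d → c * (s ! * d)) first-block (equipartitions-factorial i a) ⟩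
    (suc a * c) * (s ! * (E * (a ! * (s !) ^ a))) ≡⟨ regroup a c E (a !) (s !) ((s !) ^ a) ⟩
    (c * E) * ((suc a * a !) * (s ! * (s !) ^ a)) ∎
    where
    open ≡-Reasoning
    s = suc i
    N = s * a
    c = (i + N) C i
    E = equipartitions i a
    first-block : (s + N) C s ≡ suc a * c
    first-block = *-cancelˡ-≡ _ _ s (begin
      s * (suc (i + N) C s)   ≡⟨ C-absorption (i + N) i ⟩
      suc (i + N) * c         ≡⟨ cong (_* c) (*-suc s a) ⟨
      (s * suc a) * c         ≡⟨ *-assoc s (suc a) c ⟩
      s * (suc a * c)         ∎)
    regroup : ∀ a c e x y z → (suc a * c) * (y * (e * (x * z))) ≡ (c * e) * ((suc a * x) * (y * z))
    regroup = solve-∀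

  multinomial : ∀ {m} → ℕ → Vec ℕ m → ℕ
  multinomial i [] = 1
  multinomial i (a ∷ α) =
    ((suc i * a + wsumV (suc (suc i)) α) C (suc i * a)) * equipartitions i a * multinomial (suc i) α

  multinomial-factorial : ∀ i {m} (α : Vec ℕ m) → (wsumV (suc i) α) ! ≡ multinomial i α * denomV (suc i) α
  multinomial-factorial i [] = refl
  multinomial-factorial i (a ∷ α) = begin
    (M + W) !                                   ≡⟨ C-factorial M W ⟨
    c * (M ! * W !)                             ≡⟨ cong₂ (λ u v → c * (u * v)) (equipartitions-factorial i a)
                                                                            (multinomial-factorial (suc i) α) ⟩
    c * (E * (a ! * (suc i !) ^ a) * (μ * denomV (suc (suc i)) α))
                                                ≡⟨ regroup c E (a !) ((suc i !) ^ a) μ (denomV (suc (suc i)) α) ⟩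
    c * E * μ * (a ! * (suc i !) ^ a * denomV (suc (suc i)) α) ∎
    where
    open ≡-Reasoning
    M = suc i * a
    W = wsumV (suc (suc i)) α
    c = (M + W) C M
    E = equipartitions i a
    μ = multinomial (suc i) α
    regroup : ∀ c e x p m d → c * (e * (x * p) * (m * d)) ≡ c * e * m * (x * p * d)
    regroup = solve-∀

  denomV-nonZero : ∀ i {m} (α : Vec ℕ m) → NonZero (denomV (suc i) α)
  denomV-nonZero i [] = _
  denomV-nonZero i (a ∷ α) =
    m*n≢0 _ _ {{m*n≢0 (a !) _ {{a !≢0}} {{m^n≢0 (suc i !) a {{suc i !≢0}}}}}} {{denomV-nonZero (suc i) α}}

  factorial-div-denomV : ∀ i {m} (α : Vec ℕ m) n → wsumV (suc i) α ≡ n → (n !) div denomV (suc i) α ≡ multinomial i α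
  factorial-div-denomV i α _ refl
    rewrite multinomial-factorial i α = exact (multinomial i α) (denomV (suc i) α) {{denomV-nonZero i α}}
    where
    exact : ∀ q d → {{NonZero d}} → (q * d) div d ≡ q
    exact q (suc d) = m*n/n≡m q (suc d)

module Sums {a ℓ} (R : CommutativeRing a ℓ) where
  open import Data.Nat as ℕ using (ℕ; zero; suc; s≤s; _≤_; _<_)
  import Data.Nat.Properties as ℕ
  open import Data.Fin as Fin using (Fin; toℕ)
  open import Data.List using (List; []; _∷_; _++_; map; upTo; concatMap; filter; allFin; tabulate)
  import Data.List.Properties as List
  open import Function using (id; _∘_)
  open import Data.Sum using (inj₁; inj₂)
  open import Relation.Binary.PropositionalEquality as ≡ using (_≡_)
  open import Relation.Nullary using (Dec; yes; no)
  open import Relation.Unary using (Pred; Decidable)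
  open CommutativeRing R hiding (zero)
  open import Algebra.Properties.CommutativeSemigroup +-commutativeSemigroup using (interchange)
  open Ops R using (sumR; prodR; Σ≤)
  open IntegerSolver R using (solve; _:+_; _:-_; _:=_)
  open import Relation.Binary.Reasoning.Setoid setoid

  Σ< : ℕ → (ℕ → Carrier) → Carrier
  Σ< zero f = 0#
  Σ< (suc n) f = Σ< n f + f n

  Σ<-cong : ∀ n {f g} → (∀ k → k < n → f k ≈ g k) → Σ< n f ≈ Σ< n g
  Σ<-cong zero f≈g = refl
  Σ<-cong (suc n) f≈g = +-cong (Σ<-cong n (λ k k<n → f≈g k (ℕ.m<n⇒m<1+n k<n))) (f≈g n ℕ.≤-refl)

  Σ<-+ : ∀ n (f g : ℕ → Carrier) → Σ< n (λ k → f k + g k) ≈ Σ< n f + Σ< n g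
  Σ<-+ zero f g = sym (+-identityʳ 0#)
  Σ<-+ (suc n) f g = trans (+-congʳ (Σ<-+ n f g)) (interchange _ _ _ _)

  Σ<-*ˡ : ∀ n c (f : ℕ → Carrier) → c * Σ< n f ≈ Σ< n (λ k → c * f k)
  Σ<-*ˡ zero c f = zeroʳ c
  Σ<-*ˡ (suc n) c f = trans (distribˡ _ _ _) (+-congʳ (Σ<-*ˡ n c f))

  Σ<-zero : ∀ n {f} → (∀ k → k < n → f k ≈ 0#) → Σ< n f ≈ 0#
  Σ<-zero n f≈0 = trans (Σ<-cong n f≈0) (Σ<-0# n)
    where
    Σ<-0# : ∀ n → Σ< n (λ _ → 0#) ≈ 0#
    Σ<-0# zero = refl
    Σ<-0# (suc n) = trans (+-identityʳ _) (Σ<-0# n)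

  Σ<-head : ∀ n (f : ℕ → Carrier) → Σ< (suc n) f ≈ f 0 + Σ< n (λ k → f (suc k))
  Σ<-head zero f = trans (+-identityˡ _) (sym (+-identityʳ _))
  Σ<-head (suc n) f = trans (+-congʳ (Σ<-head n f)) (+-assoc _ _ _)

  Σ<-telescope : ∀ n (g : ℕ → Carrier) → Σ< n (λ k → g k - g (suc k)) ≈ g 0 - g n
  Σ<-telescope zero g = sym (-‿inverseʳ (g 0))
  Σ<-telescope (suc n) g = trans (+-congʳ (Σ<-telescope n g))
    (solve 3 (λ x y z → (x :- y) :+ (y :- z) := x :- z) refl (g 0) (g n) (g (suc n)))

  Σ<-truncate : ∀ m n {f} → n ≤ m → (∀ k → n ≤ k → k < m → f k ≈ 0#) → Σ< m f ≈ Σ< n f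
  Σ<-truncate m n n≤m f≈0 with ℕ.m≤n⇒m<n∨m≡n n≤m
  ... | inj₂ ≡.refl = refl
  Σ<-truncate (suc m) n n≤m f≈0 | inj₁ (s≤s n≤m′) =
    trans (+-cong (Σ<-truncate m n n≤m′ (λ k n≤k k<m → f≈0 k n≤k (ℕ.m<n⇒m<1+n k<m)))
                  (f≈0 m n≤m′ ℕ.≤-refl))
          (+-identityʳ _)

  sumR-++ : ∀ xs ys → sumR (xs ++ ys) ≈ sumR xs + sumR ys
  sumR-++ [] ys = sym (+-identityˡ _)
  sumR-++ (x ∷ xs) ys = trans (+-congˡ (sumR-++ xs ys)) (sym (+-assoc _ _ _))

  sumR-upTo : ∀ n (f : ℕ → Carrier) → sumR (map f (upTo n)) ≈ Σ< n f
  sumR-upTo zero f = refl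
  sumR-upTo (suc n) f = begin
    sumR (map f (upTo (suc n)))             ≡⟨ ≡.cong (λ l → sumR (map f l)) (List.upTo-∷ʳ n) ⟨
    sumR (map f (upTo n ++ n ∷ []))          ≡⟨ ≡.cong sumR (List.map-++ f (upTo n) (n ∷ [])) ⟩
    sumR (map f (upTo n) ++ f n ∷ [])        ≈⟨ sumR-++ (map f (upTo n)) (f n ∷ []) ⟩
    sumR (map f (upTo n)) + (f n + 0#)       ≈⟨ +-cong (sumR-upTo n f) (+-identityʳ _) ⟩
    Σ< (suc n) f                             ∎

  Σ≤≈Σ< : ∀ n (f : ℕ → Carrier) → Σ≤ n f ≈ Σ< (suc n) f
  Σ≤≈Σ< n f = sumR-upTo (suc n) f

  prodR-∷ʳ : ∀ xs y → prodR (xs ++ y ∷ []) ≈ prodR xs * y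
  prodR-∷ʳ [] y = trans (*-identityʳ y) (sym (*-identityˡ y))
  prodR-∷ʳ (x ∷ xs) y = trans (*-congˡ (prodR-∷ʳ xs y)) (sym (*-assoc _ _ _))

  sumR-allFin : ∀ n (h : Fin n → Carrier) (g : ℕ → Carrier) → (∀ p → h p ≈ g (toℕ p)) → sumR (map h (allFin n)) ≈ Σ< n g
  sumR-allFin zero h g h≈g = refl
  sumR-allFin (suc n) h g h≈g = begin
    sumR (map h (allFin (suc n)))                 ≡⟨ ≡.cong sumR (List.map-tabulate id h) ⟩
    h Fin.zero + sumR (tabulate (h ∘ Fin.suc))    ≡⟨ ≡.cong (λ l → h Fin.zero + sumR l) (List.map-tabulate id (h ∘ Fin.suc)) ⟨
    h Fin.zero + sumR (map (h ∘ Fin.suc) (allFin n)) ≈⟨ +-cong (h≈g Fin.zero) (sumR-allFin n (h ∘ Fin.suc) (g ∘ suc) (h≈g ∘ Fin.suc)) ⟩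
    g 0 + Σ< n (g ∘ suc)                          ≈⟨ Σ<-head n g ⟨
    Σ< (suc n) g                                  ∎

  indicator : ∀ {p} {Q : Set p} → Dec Q → Carrier → Carrier
  indicator (yes _) r = r
  indicator (no _) r = 0#

  module _ {A : Set} where

    sumR-cong : ∀ {f g : A → Carrier} xs → (∀ x → f x ≈ g x) → sumR (map f xs) ≈ sumR (map g xs)
    sumR-cong [] f≈g = refl
    sumR-cong (x ∷ xs) f≈g = +-cong (f≈g x) (sumR-cong xs f≈g)

    sumR-*ˡ : ∀ c (f : A → Carrier) xs → sumR (map (λ x → c * f x) xs) ≈ c * sumR (map f xs)
    sumR-*ˡ c f [] = sym (zeroʳ c)
    sumR-*ˡ c f (x ∷ xs) = trans (+-congˡ (sumR-*ˡ c f xs)) (sym (distribˡ c _ _))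

    sumR-zero : ∀ {f : A → Carrier} xs → (∀ x → f x ≈ 0#) → sumR (map f xs) ≈ 0#
    sumR-zero [] f≈0 = refl
    sumR-zero (x ∷ xs) f≈0 = trans (+-cong (f≈0 x) (sumR-zero xs f≈0)) (+-identityʳ 0#)

    sumR-concatMap : ∀ {B : Set} (f : B → Carrier) (h : A → List B) xs →
                     sumR (map f (concatMap h xs)) ≈ sumR (map (λ x → sumR (map f (h x))) xs)
    sumR-concatMap f h [] = refl
    sumR-concatMap f h (x ∷ xs) = begin
      sumR (map f (h x ++ concatMap h xs))              ≡⟨ ≡.cong sumR (List.map-++ f (h x) (concatMap h xs)) ⟩
      sumR (map f (h x) ++ map f (concatMap h xs))      ≈⟨ sumR-++ (map f (h x)) _ ⟩
      sumR (map f (h x)) + sumR (map f (concatMap h xs)) ≈⟨ +-congˡ (sumR-concatMap f h xs) ⟩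
      sumR (map (λ x → sumR (map f (h x))) (x ∷ xs))    ∎

    sumR-filter : ∀ {p} {Q : Pred A p} (Q? : Decidable Q) (f : A → Carrier) xs →
                  sumR (map f (filter Q? xs)) ≈ sumR (map (λ x → indicator (Q? x) (f x)) xs)
    sumR-filter Q? f [] = refl
    sumR-filter Q? f (x ∷ xs) with Q? x
    ... | yes _ = +-congˡ (sumR-filter Q? f xs)
    ... | no _ = trans (sumR-filter Q? f xs) (sym (+-identityˡ _))

module HurwitzSeries {a ℓ} (R : CommutativeRing a ℓ) where
  open import Data.Nat as ℕ using (ℕ; zero; suc; z≤n; s≤s; _≤_; _<_; _∸_; pred)
  import Data.Nat.Properties as ℕ
  open import Data.List using (List; []; _∷_; map)
  open import Data.Sum using (inj₁; inj₂)
  open import Data.Empty using (⊥-elim)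
  open import Data.Nat.Combinatorics using (_C_; k>n⇒nCk≡0; nCk+nC[k+1]≡[n+1]C[k+1])
  open import Function using (_∘_)
  open import Relation.Binary.PropositionalEquality as ≡ using (_≡_; _≢_)
  open import Relation.Nullary using (yes; no)
  open CommutativeRing R hiding (zero)
  open import Algebra.Properties.Semiring.Mult semiring using (_×_; ×-homo-+; ×-congʳ; ×-assocˡ; ×-comm-*)
  open import Algebra.Properties.CommutativeMonoid.Mult +-commutativeMonoid using (×-distrib-+)
  open import Algebra.Properties.CommutativeSemigroup +-commutativeSemigroup using (interchange)
  open Sums R
  open Ops R using (_^_; sumR)
  open Combinatorics using (equipartitions)
  open import Data.Nat.Tactic.RingSolver using (solve-∀)
  open import Relation.Binary.Reasoning.Setoid setoid

  -- f : Series stands for Σ f n tⁿ/n!, so that ∂ is d/dt and _⋆_, given by the Leibniz rule, is the product.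
  Series : Set a
  Series = ℕ → Carrier

  infix 4 _≋_
  _≋_ : Series → Series → Set ℓ
  f ≋ g = ∀ n → f n ≈ g n

  0ₛ one : Series
  0ₛ n = 0#
  one zero = 1#
  one (suc n) = 0#

  ∂ : Series → Series
  ∂ f n = f (suc n)

  t : Series
  t zero = 0#
  t (suc n) = one n

  infixl 6 _⊕_
  _⊕_ : Series → Series → Series
  (f ⊕ g) n = f n + g n

  scale : Carrier → Series → Series
  scale c f n = c * f n

  infixl 7 _⋆_
  _⋆_ : Series → Series → Series
  (f ⋆ g) zero = f 0 * g 0
  (f ⋆ g) (suc n) = (∂ f ⋆ g) n + (f ⋆ ∂ g) n

  VanishesBelow : ℕ → Series → Set ℓ
  VanishesBelow d f = ∀ j → j < d → f j ≈ 0#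

  ⋆-cong-≤ : ∀ n {f f′ g g′} → (∀ j → j ≤ n → f j ≈ f′ j) → (∀ j → j ≤ n → g j ≈ g′ j) →
             (f ⋆ g) n ≈ (f′ ⋆ g′) n
  ⋆-cong-≤ zero f≈ g≈ = *-cong (f≈ 0 z≤n) (g≈ 0 z≤n)
  ⋆-cong-≤ (suc n) f≈ g≈ =
    +-cong (⋆-cong-≤ n (λ j j≤n → f≈ (suc j) (s≤s j≤n)) (λ j j≤n → g≈ j (ℕ.m≤n⇒m≤1+n j≤n)))
           (⋆-cong-≤ n (λ j j≤n → f≈ j (ℕ.m≤n⇒m≤1+n j≤n)) (λ j j≤n → g≈ (suc j) (s≤s j≤n)))

  ⋆-cong : ∀ {f f′ g g′} → f ≋ f′ → g ≋ g′ → f ⋆ g ≋ f′ ⋆ g′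
  ⋆-cong f≈ g≈ n = ⋆-cong-≤ n (λ j _ → f≈ j) (λ j _ → g≈ j)

  ⋆-comm : ∀ f g → f ⋆ g ≋ g ⋆ f
  ⋆-comm f g zero = *-comm _ _
  ⋆-comm f g (suc n) = trans (+-cong (⋆-comm (∂ f) g n) (⋆-comm f (∂ g) n)) (+-comm _ _)

  ⋆-distribʳ-⊕ : ∀ f g h → (f ⊕ g) ⋆ h ≋ f ⋆ h ⊕ g ⋆ h
  ⋆-distribʳ-⊕ f g h zero = distribʳ _ _ _
  ⋆-distribʳ-⊕ f g h (suc n) =
    trans (+-cong (⋆-distribʳ-⊕ (∂ f) (∂ g) h n) (⋆-distribʳ-⊕ f g (∂ h) n)) (interchange _ _ _ _)

  ⋆-distribˡ-⊕ : ∀ h f g → h ⋆ (f ⊕ g) ≋ h ⋆ f ⊕ h ⋆ g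
  ⋆-distribˡ-⊕ h f g n =
    trans (⋆-comm h (f ⊕ g) n) (trans (⋆-distribʳ-⊕ f g h n) (+-cong (⋆-comm f h n) (⋆-comm g h n)))

  scale-⋆ : ∀ c f g → scale c f ⋆ g ≋ scale c (f ⋆ g)
  scale-⋆ c f g zero = *-assoc _ _ _
  scale-⋆ c f g (suc n) = trans (+-cong (scale-⋆ c (∂ f) g n) (scale-⋆ c f (∂ g) n)) (sym (distribˡ _ _ _))

  ⋆-scale : ∀ c f g → f ⋆ scale c g ≋ scale c (f ⋆ g)
  ⋆-scale c f g n = trans (⋆-comm f (scale c g) n) (trans (scale-⋆ c g f n) (*-congˡ (⋆-comm g f n)))

  ⋆-zeroˡ : ∀ {f} g → f ≋ 0ₛ → f ⋆ g ≋ 0ₛ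
  ⋆-zeroˡ g f≈0 zero = trans (*-congʳ (f≈0 0)) (zeroˡ _)
  ⋆-zeroˡ g f≈0 (suc n) =
    trans (+-cong (⋆-zeroˡ g (λ j → f≈0 (suc j)) n) (⋆-zeroˡ (∂ g) f≈0 n)) (+-identityʳ 0#)

  ⋆-zeroʳ : ∀ f {g} → g ≋ 0ₛ → f ⋆ g ≋ 0ₛ
  ⋆-zeroʳ f {g} g≈0 n = trans (⋆-comm f g n) (⋆-zeroˡ f g≈0 n)

  ⋆-identityˡ : ∀ g → one ⋆ g ≋ g
  ⋆-identityˡ g zero = *-identityˡ _
  ⋆-identityˡ g (suc n) = trans (+-cong (⋆-zeroˡ g (λ _ → refl) n) (⋆-identityˡ (∂ g) n)) (+-identityˡ _)

  ⋆-identityʳ : ∀ g → g ⋆ one ≋ g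
  ⋆-identityʳ g n = trans (⋆-comm g one n) (⋆-identityˡ g n)

  ⋆-assoc : ∀ f g h → (f ⋆ g) ⋆ h ≋ f ⋆ (g ⋆ h)
  ⋆-assoc f g h zero = *-assoc _ _ _
  ⋆-assoc f g h (suc n) = begin
    ((∂ f ⋆ g ⊕ f ⋆ ∂ g) ⋆ h) n + ((f ⋆ g) ⋆ ∂ h) n
      ≈⟨ +-congʳ (⋆-distribʳ-⊕ (∂ f ⋆ g) (f ⋆ ∂ g) h n) ⟩
    (((∂ f ⋆ g) ⋆ h) n + ((f ⋆ ∂ g) ⋆ h) n) + ((f ⋆ g) ⋆ ∂ h) n
      ≈⟨ +-cong (+-cong (⋆-assoc (∂ f) g h n) (⋆-assoc f (∂ g) h n)) (⋆-assoc f g (∂ h) n) ⟩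
    ((∂ f ⋆ (g ⋆ h)) n + (f ⋆ (∂ g ⋆ h)) n) + (f ⋆ (g ⋆ ∂ h)) n
      ≈⟨ +-assoc _ _ _ ⟩
    (∂ f ⋆ (g ⋆ h)) n + ((f ⋆ (∂ g ⋆ h)) n + (f ⋆ (g ⋆ ∂ h)) n)
      ≈⟨ +-congˡ (⋆-distribˡ-⊕ f (∂ g ⋆ h) (g ⋆ ∂ h) n) ⟨
    (∂ f ⋆ (g ⋆ h)) n + (f ⋆ (∂ g ⋆ h ⊕ g ⋆ ∂ h)) n ∎

  ⋆-left-comm : ∀ f g h → f ⋆ (g ⋆ h) ≋ g ⋆ (f ⋆ h)
  ⋆-left-comm f g h n =
    trans (sym (⋆-assoc f g h n)) (trans (⋆-cong (⋆-comm f g) (λ _ → refl) n) (⋆-assoc g f h n))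

  ∂-vanishesBelow : ∀ {d f} → VanishesBelow d f → VanishesBelow (pred d) (∂ f)
  ∂-vanishesBelow {suc d} f₀ j j<d = f₀ (suc j) (s≤s j<d)

  private
    <-pred-+ : ∀ {n} d₁ d₂ → suc n < d₁ ℕ.+ d₂ → n < pred d₁ ℕ.+ d₂
    <-pred-+ zero d₂ (s≤s n<d) = ℕ.m<n⇒m<1+n n<d
    <-pred-+ (suc d₁) d₂ (s≤s n<d) = n<d

    <-+-pred : ∀ {n} d₁ d₂ → suc n < d₁ ℕ.+ d₂ → n < d₁ ℕ.+ pred d₂
    <-+-pred {n} d₁ d₂ n<d = ≡.subst (n <_) (ℕ.+-comm (pred d₂) d₁)
                               (<-pred-+ d₂ d₁ (≡.subst (suc n <_) (ℕ.+-comm d₁ d₂) n<d))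

  ⋆-vanishesBelow : ∀ {d₁ d₂ f g} → VanishesBelow d₁ f → VanishesBelow d₂ g → VanishesBelow (d₁ ℕ.+ d₂) (f ⋆ g)
  ⋆-vanishesBelow {suc d₁} f₀ g₀ zero _ = trans (*-congʳ (f₀ 0 (s≤s z≤n))) (zeroˡ _)
  ⋆-vanishesBelow {zero} {suc d₂} f₀ g₀ zero _ = trans (*-congˡ (g₀ 0 (s≤s z≤n))) (zeroʳ _)
  ⋆-vanishesBelow {d₁} {d₂} f₀ g₀ (suc n) n<d =
    trans (+-cong (⋆-vanishesBelow (∂-vanishesBelow f₀) g₀ n (<-pred-+ d₁ d₂ n<d))
                  (⋆-vanishesBelow f₀ (∂-vanishesBelow g₀) n (<-+-pred d₁ d₂ n<d)))
          (+-identityʳ 0#)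

  ⋆-vanishesBelowˡ : ∀ {d f} g → VanishesBelow d f → VanishesBelow d (f ⋆ g)
  ⋆-vanishesBelowˡ {d} g f₀ n n<d = ⋆-vanishesBelow {d₂ = 0} f₀ (λ _ ()) n (≡.subst (n <_) (≡.sym (ℕ.+-identityʳ d)) n<d)

  ⋆-×ʳ : ∀ m f g → f ⋆ (λ j → m × g j) ≋ (λ n → m × (f ⋆ g) n)
  ⋆-×ʳ m f g zero = ×-comm-* m (f 0) (g 0)
  ⋆-×ʳ m f g (suc n) = trans (+-cong (⋆-×ʳ m (∂ f) g n) (⋆-×ʳ m f (∂ g) n)) (sym (×-distrib-+ _ _ m))

  ⋆-Σ<ˡ : ∀ K (F : ℕ → Series) g → (λ j → Σ< K (λ k → F k j)) ⋆ g ≋ (λ n → Σ< K (λ k → (F k ⋆ g) n))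
  ⋆-Σ<ˡ zero F g = ⋆-zeroˡ g (λ _ → refl)
  ⋆-Σ<ˡ (suc K) F g n = trans (⋆-distribʳ-⊕ (λ j → Σ< K (λ k → F k j)) (F K) g n) (+-congʳ (⋆-Σ<ˡ K F g n))

  ⋆-Σ<ʳ : ∀ K (F : ℕ → Series) g → g ⋆ (λ j → Σ< K (λ k → F k j)) ≋ (λ n → Σ< K (λ k → (g ⋆ F k) n))
  ⋆-Σ<ʳ K F g n =
    trans (⋆-comm g _ n) (trans (⋆-Σ<ˡ K F g n) (Σ<-cong K (λ k _ → ⋆-comm (F k) g n)))

  ⋆-sumRʳ : ∀ {A : Set} (xs : List A) (F : A → Series) g →
            g ⋆ (λ j → sumR (map (λ t → F t j) xs)) ≋ (λ n → sumR (map (λ t → (g ⋆ F t) n) xs))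
  ⋆-sumRʳ [] F g = ⋆-zeroʳ g (λ _ → refl)
  ⋆-sumRʳ (t ∷ xs) F g n = trans (⋆-distribˡ-⊕ g (F t) _ n) (+-congˡ (⋆-sumRʳ xs F g n))

  monomial : ℕ → Carrier → Series
  monomial zero r zero = r
  monomial zero r (suc j) = 0#
  monomial (suc m) r zero = 0#
  monomial (suc m) r (suc j) = monomial m r j

  monomial-at : ∀ m r → monomial m r m ≈ r
  monomial-at zero r = refl
  monomial-at (suc m) r = monomial-at m r

  monomial-off : ∀ m r {j} → j ≢ m → monomial m r j ≈ 0#
  monomial-off zero r {zero} j≢m = ⊥-elim (j≢m ≡.refl)
  monomial-off zero r {suc j} j≢m = refl
  monomial-off (suc m) r {zero} j≢m = refl
  monomial-off (suc m) r {suc j} j≢m = monomial-off m r (j≢m ∘ ≡.cong suc)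

  ×-zeroʳ : ∀ n → n × 0# ≈ 0#
  ×-zeroʳ zero = refl
  ×-zeroʳ (suc n) = trans (+-identityˡ _) (×-zeroʳ n)

  ⋆-monomialˡ : ∀ p r g n → (monomial p r ⋆ g) n ≈ (n C p) × (r * g (n ∸ p))
  ⋆-monomialˡ zero r g zero = sym (+-identityʳ _)
  ⋆-monomialˡ (suc p) r g zero = zeroˡ _
  ⋆-monomialˡ zero r g (suc n) =
    trans (+-cong (⋆-zeroˡ g (λ _ → refl) n) (⋆-monomialˡ zero r (∂ g) n)) (+-identityˡ _)
  ⋆-monomialˡ (suc p) r g (suc n) = begin
    (monomial p r ⋆ g) n + (monomial (suc p) r ⋆ ∂ g) n
      ≈⟨ +-cong (⋆-monomialˡ p r g n) (⋆-monomialˡ (suc p) r (∂ g) n) ⟩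
    (n C p) × (r * g (n ∸ p)) + (n C suc p) × (r * g (suc (n ∸ suc p)))
      ≈⟨ +-congˡ shift ⟩
    (n C p) × (r * g (n ∸ p)) + (n C suc p) × (r * g (n ∸ p))
      ≈⟨ ×-homo-+ _ (n C p) (n C suc p) ⟨
    (n C p ℕ.+ n C suc p) × (r * g (n ∸ p))
      ≡⟨ ≡.cong (_× (r * g (n ∸ p))) (nCk+nC[k+1]≡[n+1]C[k+1] n p) ⟩
    (suc n C suc p) × (r * g (suc n ∸ suc p)) ∎
    where
    shift : (n C suc p) × (r * g (suc (n ∸ suc p))) ≈ (n C suc p) × (r * g (n ∸ p))
    shift with ℕ.<-≤-connex p n
    ... | inj₁ p<n = reflexive (≡.cong (λ j → (n C suc p) × (r * g j)) (≡.sym (ℕ.+-∸-assoc 1 p<n)))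
    ... | inj₂ n≤p rewrite k>n⇒nCk≡0 (s≤s n≤p) = refl

  monomial-⋆-monomial : ∀ p q r r′ → monomial p r ⋆ monomial q r′ ≋ monomial (p ℕ.+ q) (((p ℕ.+ q) C p) × (r * r′))
  monomial-⋆-monomial p q r r′ n with n ℕ.≟ p ℕ.+ q
  ... | yes ≡.refl = begin
    (monomial p r ⋆ monomial q r′) (p ℕ.+ q)                  ≈⟨ ⋆-monomialˡ p r (monomial q r′) (p ℕ.+ q) ⟩
    ((p ℕ.+ q) C p) × (r * monomial q r′ (p ℕ.+ q ∸ p))       ≡⟨ ≡.cong (λ j → ((p ℕ.+ q) C p) × (r * monomial q r′ j)) (ℕ.m+n∸m≡n p q) ⟩
    ((p ℕ.+ q) C p) × (r * monomial q r′ q)                   ≈⟨ ×-congʳ ((p ℕ.+ q) C p) (*-congˡ (monomial-at q r′)) ⟩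
    ((p ℕ.+ q) C p) × (r * r′)                                ≈⟨ monomial-at (p ℕ.+ q) _ ⟨
    monomial (p ℕ.+ q) (((p ℕ.+ q) C p) × (r * r′)) (p ℕ.+ q) ∎
  ... | no n≢p+q = trans (trans (⋆-monomialˡ p r (monomial q r′) n) vanishes) (sym (monomial-off (p ℕ.+ q) _ n≢p+q))
    where
    vanishes : (n C p) × (r * monomial q r′ (n ∸ p)) ≈ 0#
    vanishes with ℕ.≤-<-connex p n
    ... | inj₁ p≤n = trans (×-congʳ (n C p) (trans (*-congˡ (monomial-off q r′ n∸p≢q)) (zeroʳ r))) (×-zeroʳ (n C p))
      where
      n∸p≢q : n ∸ p ≢ q
      n∸p≢q n∸p≡q = n≢p+q (≡.trans (≡.sym (ℕ.m+[n∸m]≡n p≤n)) (≡.cong (p ℕ.+_) n∸p≡q))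
    ... | inj₂ n<p rewrite k>n⇒nCk≡0 n<p = refl

  dropBelow : ℕ → Series → Series
  dropBelow zero y = y
  dropBelow (suc i) y zero = 0#
  dropBelow (suc i) y (suc j) = dropBelow i (∂ y) j

  dropBelow-split : ∀ i y → dropBelow i y ≋ monomial i (y i) ⊕ dropBelow (suc i) y
  dropBelow-split zero y zero = sym (+-identityʳ _)
  dropBelow-split zero y (suc j) = sym (+-identityˡ _)
  dropBelow-split (suc i) y zero = sym (+-identityˡ 0#)
  dropBelow-split (suc i) y (suc j) = dropBelow-split i (∂ y) j

  dropBelow-vanishesBelow : ∀ i y → VanishesBelow i (dropBelow i y)
  dropBelow-vanishesBelow (suc i) y zero _ = refl
  dropBelow-vanishesBelow (suc i) y (suc j) (s≤s j<i) = dropBelow-vanishesBelow i (∂ y) j j<i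

  -- dpow k f is the divided power (f - f 0)^k / k!, defined through (dpow (1 + k) f)′ = f′ ⋆ dpow k f.
  dpow : ℕ → Series → Series
  dpow zero f = one
  dpow (suc k) f zero = 0#
  dpow (suc k) f (suc n) = (∂ f ⋆ dpow k f) n

  dpow-cong : ∀ k {f f′} → f ≋ f′ → dpow k f ≋ dpow k f′
  dpow-cong zero f≈ n = refl
  dpow-cong (suc k) f≈ zero = refl
  dpow-cong (suc k) f≈ (suc n) = ⋆-cong (λ j → f≈ (suc j)) (dpow-cong k f≈) n

  dpow-vanishesBelow : ∀ {d f} → VanishesBelow d f → ∀ k → VanishesBelow (d ℕ.* k) (dpow k f)
  dpow-vanishesBelow {d} f₀ zero n n<0 = ⊥-elim (ℕ.n≮0 (≡.subst (n <_) (ℕ.*-zeroʳ d) n<0))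
  dpow-vanishesBelow f₀ (suc k) zero _ = refl
  dpow-vanishesBelow {d} f₀ (suc k) (suc n) n<dk =
    ⋆-vanishesBelow (∂-vanishesBelow f₀) (dpow-vanishesBelow f₀ k) n
      (<-pred-+ d (d ℕ.* k) (≡.subst (suc n <_) (ℕ.*-suc d k) n<dk))

  dpow-⊕ : ∀ k f g → dpow k (f ⊕ g) ≋ (λ n → Σ< (suc k) (λ i → (dpow i f ⋆ dpow (k ∸ i) g) n))
  dpow-⊕ zero f g n = trans (sym (⋆-identityˡ one n)) (sym (+-identityˡ _))
  dpow-⊕ (suc k) f g zero = sym (Σ<-zero (suc (suc k)) at-zero)
    where
    at-zero : ∀ i → i < suc (suc k) → (dpow i f ⋆ dpow (suc k ∸ i) g) 0 ≈ 0#
    at-zero zero _ = zeroʳ _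
    at-zero (suc i) _ = zeroˡ _
  dpow-⊕ (suc k) f g (suc n) = begin
    ((∂ f ⊕ ∂ g) ⋆ dpow k (f ⊕ g)) n         ≈⟨ ⋆-cong (λ _ → refl) (dpow-⊕ k f g) n ⟩
    ((∂ f ⊕ ∂ g) ⋆ S) n                      ≈⟨ ⋆-distribʳ-⊕ (∂ f) (∂ g) S n ⟩
    (∂ f ⋆ S) n + (∂ g ⋆ S) n                ≈⟨ +-cong ∂f-part ∂g-part ⟨
    Σ< (suc (suc k)) (λ i → (∂ (dpow i f) ⋆ dpow (suc k ∸ i) g) n)
      + Σ< (suc (suc k)) (λ i → (dpow i f ⋆ ∂ (dpow (suc k ∸ i) g)) n)
                                             ≈⟨ Σ<-+ (suc (suc k)) _ _ ⟨
    Σ< (suc (suc k)) (λ i → (dpow i f ⋆ dpow (suc k ∸ i) g) (suc n)) ∎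
    where
    S : Series
    S j = Σ< (suc k) (λ i → (dpow i f ⋆ dpow (k ∸ i) g) j)
    ∂f-part : Σ< (suc (suc k)) (λ i → (∂ (dpow i f) ⋆ dpow (suc k ∸ i) g) n) ≈ (∂ f ⋆ S) n
    ∂f-part = begin
      Σ< (suc (suc k)) (λ i → (∂ (dpow i f) ⋆ dpow (suc k ∸ i) g) n)
        ≈⟨ Σ<-head (suc k) _ ⟩
      (∂ one ⋆ dpow (suc k) g) n + Σ< (suc k) (λ i → ((∂ f ⋆ dpow i f) ⋆ dpow (k ∸ i) g) n)
        ≈⟨ +-cong (⋆-zeroˡ (dpow (suc k) g) (λ _ → refl) n) (Σ<-cong (suc k) (λ i _ → ⋆-assoc (∂ f) _ _ n)) ⟩
      0# + Σ< (suc k) (λ i → (∂ f ⋆ (dpow i f ⋆ dpow (k ∸ i) g)) n)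
        ≈⟨ +-identityˡ _ ⟩
      Σ< (suc k) (λ i → (∂ f ⋆ (dpow i f ⋆ dpow (k ∸ i) g)) n)
        ≈⟨ ⋆-Σ<ʳ (suc k) (λ i → dpow i f ⋆ dpow (k ∸ i) g) (∂ f) n ⟨
      (∂ f ⋆ S) n ∎
    ∂g-term : ∀ i → i < suc k → (dpow i f ⋆ ∂ (dpow (suc k ∸ i) g)) n ≈ (∂ g ⋆ (dpow i f ⋆ dpow (k ∸ i) g)) n
    ∂g-term i (s≤s i≤k) = trans (⋆-cong (λ _ → refl) (λ j → reflexive (≡.cong (λ m → dpow m g (suc j)) (ℕ.+-∸-assoc 1 i≤k))) n)
                                (⋆-left-comm (dpow i f) (∂ g) _ n)
    ∂g-part : Σ< (suc (suc k)) (λ i → (dpow i f ⋆ ∂ (dpow (suc k ∸ i) g)) n) ≈ (∂ g ⋆ S) n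
    ∂g-part = begin
      Σ< (suc k) (λ i → (dpow i f ⋆ ∂ (dpow (suc k ∸ i) g)) n) + (dpow (suc k) f ⋆ ∂ (dpow (suc k ∸ suc k) g)) n
        ≈⟨ +-cong (Σ<-cong (suc k) ∂g-term) (⋆-zeroʳ (dpow (suc k) f) (λ j → reflexive (≡.cong (λ m → dpow m g (suc j)) (ℕ.n∸n≡0 k))) n) ⟩
      Σ< (suc k) (λ i → (∂ g ⋆ (dpow i f ⋆ dpow (k ∸ i) g)) n) + 0#
        ≈⟨ +-identityʳ _ ⟩
      Σ< (suc k) (λ i → (∂ g ⋆ (dpow i f ⋆ dpow (k ∸ i) g)) n)
        ≈⟨ ⋆-Σ<ʳ (suc k) (λ i → dpow i f ⋆ dpow (k ∸ i) g) (∂ g) n ⟨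
      (∂ g ⋆ S) n ∎

  monomial-cong : ∀ m {r r′} → r ≈ r′ → monomial m r ≋ monomial m r′
  monomial-cong zero r≈ zero = r≈
  monomial-cong zero r≈ (suc j) = refl
  monomial-cong (suc m) r≈ zero = refl
  monomial-cong (suc m) r≈ (suc j) = monomial-cong m r≈ j

  dpow-monomial : ∀ i c k → dpow k (monomial (suc i) c) ≋ monomial (suc i ℕ.* k) (equipartitions i k × (c ^ k))
  dpow-monomial i c zero n = begin
    one n                       ≈⟨ one≈monomial n ⟩
    monomial 0 (1 × 1#) n       ≡⟨ ≡.cong (λ m → monomial m (1 × 1#) n) (ℕ.*-zeroʳ (suc i)) ⟨
    monomial (suc i ℕ.* 0) (1 × 1#) n ∎
    where
    one≈monomial : one ≋ monomial 0 (1 × 1#)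
    one≈monomial zero = sym (+-identityʳ 1#)
    one≈monomial (suc n) = refl
  dpow-monomial i c (suc k) zero = refl
  dpow-monomial i c (suc k) (suc n) = begin
    (monomial i c ⋆ dpow k (monomial (suc i) c)) n          ≈⟨ ⋆-cong (λ _ → refl) (dpow-monomial i c k) n ⟩
    (monomial i c ⋆ monomial (suc i ℕ.* k) X) n            ≈⟨ monomial-⋆-monomial i (suc i ℕ.* k) c X n ⟩
    monomial (i ℕ.+ suc i ℕ.* k) (B × (c * X)) n          ≈⟨ monomial-cong (i ℕ.+ suc i ℕ.* k) coefficient n ⟩
    monomial (i ℕ.+ suc i ℕ.* k) ((B ℕ.* E) × (c * c ^ k)) n ≡⟨ ≡.cong (λ m → monomial m ((B ℕ.* E) × (c * c ^ k)) n) (index i k) ⟨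
    monomial (k ℕ.+ i ℕ.* suc k) ((B ℕ.* E) × (c * c ^ k)) n ∎
    where
    E = equipartitions i k
    B = (i ℕ.+ suc i ℕ.* k) C i
    X = E × (c ^ k)
    coefficient : B × (c * X) ≈ (B ℕ.* E) × (c * c ^ k)
    coefficient = trans (×-congʳ B (×-comm-* E c (c ^ k))) (×-assocˡ _ B E)
    index : ∀ i k → k ℕ.+ i ℕ.* suc k ≡ i ℕ.+ suc i ℕ.* k
    index = solve-∀

  dpow-dropBelow : ∀ i y k n →
    dpow k (dropBelow (suc i) y) n ≈
    Σ< (suc k) (λ a → (n C (suc i ℕ.* a)) ×
                      ((equipartitions i a × (y (suc i) ^ a)) * dpow (k ∸ a) (dropBelow (suc (suc i)) y) (n ∸ suc i ℕ.* a)))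
  dpow-dropBelow i y k n =
    trans (dpow-cong k (dropBelow-split (suc i) y) n) (trans (dpow-⊕ k _ _ n) (Σ<-cong (suc k) term))
    where
    term : ∀ a → a < suc k →
           (dpow a (monomial (suc i) (y (suc i))) ⋆ dpow (k ∸ a) (dropBelow (suc (suc i)) y)) n ≈
           (n C (suc i ℕ.* a)) × ((equipartitions i a × (y (suc i) ^ a)) * dpow (k ∸ a) (dropBelow (suc (suc i)) y) (n ∸ suc i ℕ.* a))
    term a _ = trans (⋆-cong (dpow-monomial i (y (suc i)) a) (λ _ → refl) n) (⋆-monomialˡ (suc i ℕ.* a) _ _ n)

module BellPolynomials {a ℓ} (R : CommutativeRing a ℓ) where
  open import Data.Nat as ℕ using (ℕ; zero; suc; s≤s; _≤_; _<_; _∸_; _!)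
  import Data.Nat.Properties as ℕ
  open import Data.Nat.Combinatorics using (_C_; k>n⇒nCk≡0)
  open import Data.List using ([]; _∷_; map; upTo; concatMap)
  import Data.List.Properties as List
  open import Data.Vec using (Vec; []; _∷_)
  open import Data.Product using (_,_) renaming (_×_ to _∧_)
  open import Data.Sum using (_⊎_; inj₁; inj₂)
  open import Data.Empty using (⊥-elim)
  open import Relation.Nullary using (¬_; Dec; yes; no)
  open import Relation.Nullary.Decidable using (_×-dec_)
  open import Relation.Binary.PropositionalEquality as ≡ using (_≡_)
  open CommutativeRing R hiding (zero)
  open import Algebra.Properties.Semiring.Mult semiring using (_×_; ×-congʳ; ×-assocˡ; ×-comm-*; ×-assoc-*)
  open Ops R using (_·_; _^_; sumR; monoV; B)
  open Sums R
  open HurwitzSeries R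
  open Combinatorics using (equipartitions; multinomial; factorial-div-denomV)
  open import Data.Nat.Tactic.RingSolver using (solve-∀)
  open import Relation.Binary.Reasoning.Setoid setoid

  ·≡× : ∀ n r → n · r ≡ n × r
  ·≡× zero r = ≡.refl
  ·≡× (suc n) r = ≡.cong (r +_) (·≡× n r)

  ×-regroup : ∀ c k μ r m → ((c ℕ.* k) ℕ.* μ) × (r * m) ≈ (c × (k × r)) * (μ × m)
  ×-regroup c k μ r m = sym (begin
    (c × (k × r)) * (μ × m)    ≈⟨ ×-assoc-* c (k × r) (μ × m) ⟩
    c × ((k × r) * (μ × m))    ≈⟨ ×-congʳ c (×-assoc-* k r (μ × m)) ⟩
    c × (k × (r * (μ × m)))    ≈⟨ ×-congʳ c (×-congʳ k (×-comm-* μ r m)) ⟩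
    c × (k × (μ × (r * m)))    ≈⟨ ×-congʳ c (×-assocˡ (r * m) k μ) ⟩
    c × ((k ℕ.* μ) × (r * m))  ≈⟨ ×-assocˡ (r * m) c (k ℕ.* μ) ⟩
    (c ℕ.* (k ℕ.* μ)) × (r * m) ≡⟨ ≡.cong (_× (r * m)) (ℕ.*-assoc c k μ) ⟨
    ((c ℕ.* k) ℕ.* μ) × (r * m) ∎)

  IsBellIndex : ℕ → ℕ → ℕ → ∀ {m} → Vec ℕ m → Set
  IsBellIndex i n k α = (sumV α ≡ k) ∧ (wsumV i α ≡ n)

  isBellIndex? : ∀ i n k {m} (α : Vec ℕ m) → Dec (IsBellIndex i n k α)
  isBellIndex? i n k α = (sumV α ℕ.≟ k) ×-dec (wsumV i α ℕ.≟ n)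

  -- α = (α_{i+1}, α_{i+2}, …), where α_j counts the blocks of size j.
  bellTerm : ℕ → ℕ → ℕ → (ℕ → Carrier) → ∀ {m} → Vec ℕ m → Carrier
  bellTerm i n k y α = indicator (isBellIndex? (suc i) n k α) (multinomial i α × monoV y (suc i) α)

  partialBell : (i L bound n k : ℕ) → (ℕ → Carrier) → Carrier
  partialBell i L bound n k y = sumR (map (bellTerm i n k y) (allVecs L bound))

  B≈partialBell : ∀ n k y → B n k y ≈ partialBell 0 (suc (n ∸ k)) (n ℕ.+ k) n k y
  B≈partialBell n k y =
    trans (sumR-filter (isBellIndex? 1 n k) _ (allVecs (suc (n ∸ k)) (n ℕ.+ k)))
          (sumR-cong (allVecs (suc (n ∸ k)) (n ℕ.+ k)) coefficient)
    where
    coefficient : ∀ α → indicator (isBellIndex? 1 n k α) (((n !) div denomV 1 α) · monoV y 1 α)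
                        ≈ bellTerm 0 n k y α
    coefficient α with isBellIndex? 1 n k α
    ... | yes (_ , weight) = reflexive (≡.trans (·≡× ((n !) div denomV 1 α) (monoV y 1 α)) (≡.cong (_× monoV y 1 α) (factorial-div-denomV 0 α n weight)))
    ... | no _ = refl

  partialBell-suc : ∀ i L bound n k y →
    partialBell i (suc L) bound n k y ≈ Σ< (suc bound) (λ a → sumR (map (λ α → bellTerm i n k y (a ∷ α)) (allVecs L bound)))
  partialBell-suc i L bound n k y = begin
    sumR (map (bellTerm i n k y) (concatMap (λ a → map (a ∷_) (allVecs L bound)) (upTo (suc bound))))
      ≈⟨ sumR-concatMap (bellTerm i n k y) (λ a → map (a ∷_) (allVecs L bound)) (upTo (suc bound)) ⟩
    sumR (map (λ a → sumR (map (bellTerm i n k y) (map (a ∷_) (allVecs L bound)))) (upTo (suc bound)))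
      ≡⟨ ≡.cong sumR (List.map-cong (λ a → ≡.cong sumR (≡.sym (List.map-∘ (allVecs L bound)))) (upTo (suc bound))) ⟩
    sumR (map (λ a → sumR (map (λ α → bellTerm i n k y (a ∷ α)) (allVecs L bound))) (upTo (suc bound)))
      ≈⟨ sumR-upTo (suc bound) _ ⟩
    Σ< (suc bound) (λ a → sumR (map (λ α → bellTerm i n k y (a ∷ α)) (allVecs L bound))) ∎

  bellTerm-∷ : ∀ i n k y a {m} (α : Vec ℕ m) → a ≤ k → suc i ℕ.* a ≤ n →
    bellTerm i n k y (a ∷ α) ≈
    ((n C (suc i ℕ.* a)) × (equipartitions i a × (y (suc i) ^ a))) * bellTerm (suc i) (n ∸ suc i ℕ.* a) (k ∸ a) y α
  bellTerm-∷ i n k y a α a≤k sa≤n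
    with isBellIndex? (suc i) n k (a ∷ α) | isBellIndex? (suc (suc i)) (n ∸ suc i ℕ.* a) (k ∸ a) α
  ... | yes (_ , ≡.refl) | yes _ =
    ×-regroup ((suc i ℕ.* a ℕ.+ wsumV (suc (suc i)) α) C (suc i ℕ.* a)) (equipartitions i a) (multinomial (suc i) α) (y (suc i) ^ a) (monoV y (suc (suc i)) α)
  ... | yes (size , weight) | no ¬tail = ⊥-elim (¬tail
        ( ≡.trans (≡.sym (ℕ.m+n∸m≡n a _)) (≡.cong (_∸ a) size)
        , ≡.trans (≡.sym (ℕ.m+n∸m≡n (suc i ℕ.* a) _)) (≡.cong (_∸ suc i ℕ.* a) weight)))
  ... | no ¬whole | yes (size , weight) = ⊥-elim (¬whole
        ( ≡.trans (≡.cong (a ℕ.+_) size) (ℕ.m+[n∸m]≡n a≤k)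
        , ≡.trans (≡.cong (suc i ℕ.* a ℕ.+_) weight) (ℕ.m+[n∸m]≡n sa≤n)))
  ... | no _ | no _ = sym (zeroʳ _)

  bellTerm-∷-zero : ∀ i n k y a {m} (α : Vec ℕ m) → ¬ a ≤ k ⊎ ¬ suc i ℕ.* a ≤ n → bellTerm i n k y (a ∷ α) ≈ 0#
  bellTerm-∷-zero i n k y a α out-of-range with isBellIndex? (suc i) n k (a ∷ α) | out-of-range
  ... | no _ | _ = refl
  ... | yes (size , _) | inj₁ a≰k = ⊥-elim (a≰k (≡.subst (a ≤_) size (ℕ.m≤m+n a _)))
  ... | yes (_ , weight) | inj₂ sa≰n = ⊥-elim (sa≰n (≡.subst (suc i ℕ.* a ≤_) weight (ℕ.m≤m+n _ _)))

  -- For k > 0 this guarantees that a partition of n into k blocks of sizes above i only uses the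
  -- sizes i + 1, …, i + L, i.e. those recorded by index vectors of length L.
  LongEnough : (i L n k : ℕ) → Set
  LongEnough i L n k = k ≡ 0 ⊎ n < k ℕ.* suc i ℕ.+ L

  longEnough-initial : ∀ n k → LongEnough 0 (suc (n ∸ k)) n k
  longEnough-initial n k = inj₂ (≡.subst (n <_) (≡.cong₂ ℕ._+_ (≡.sym (ℕ.*-identityʳ k)) ≡.refl)
                                  (≡.subst (n <_) (≡.sym (ℕ.+-suc k (n ∸ k))) (s≤s (ℕ.m≤n+m∸n n k))))

  longEnough-step : ∀ {i L n k a} → a ≤ k → suc i ℕ.* a ≤ n →
                    LongEnough i (suc L) n k → LongEnough (suc i) L (n ∸ suc i ℕ.* a) (k ∸ a)
  longEnough-step {i} {L} {n} {k} {a} a≤k sa≤n longEnough with k ∸ a in k∸a≡ | longEnough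
  ... | zero | _ = inj₁ ≡.refl
  ... | suc d | inj₁ ≡.refl = ⊥-elim (ℕ.0≢1+n (≡.trans (≡.sym (ℕ.0∸n≡0 a)) k∸a≡))
  ... | suc d | inj₂ n< = inj₂ (ℕ.<-≤-trans remainder< bound)
    where
    s = suc i
    r = n ∸ s ℕ.* a
    split : ∀ s a d L → (a ℕ.+ suc d) ℕ.* s ℕ.+ suc L ≡ s ℕ.* a ℕ.+ (suc d ℕ.* s ℕ.+ suc L)
    split = solve-∀
    regroup : ∀ s d L → suc d ℕ.* suc s ℕ.+ L ≡ (suc d ℕ.* s ℕ.+ suc L) ℕ.+ d
    regroup = solve-∀
    k≡ : k ≡ a ℕ.+ suc d
    k≡ = ≡.trans (≡.sym (ℕ.m+[n∸m]≡n a≤k)) (≡.cong (a ℕ.+_) k∸a≡)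
    remainder< : r < suc d ℕ.* s ℕ.+ suc L
    remainder< = ℕ.+-cancelˡ-< (s ℕ.* a) r _
      (≡.subst₂ _<_ (≡.sym (ℕ.m+[n∸m]≡n sa≤n)) (≡.trans (≡.cong (λ k → k ℕ.* s ℕ.+ suc L) k≡) (split s a d L)) n<)
    bound : suc d ℕ.* s ℕ.+ suc L ≤ suc d ℕ.* suc s ℕ.+ L
    bound = ≡.subst (suc d ℕ.* s ℕ.+ suc L ≤_) (≡.sym (regroup s d L)) (ℕ.m≤m+n _ d)

  partialBell-dpow : ∀ L i bound n k y → k ≤ bound → LongEnough i L n k →
                     partialBell i L bound n k y ≈ dpow k (dropBelow (suc i) y) n
  partialBell-dpow zero i bound zero zero y _ _ = trans (+-identityʳ _) (+-identityʳ 1#)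
  partialBell-dpow zero i bound (suc n) zero y _ _ = +-identityʳ _
  partialBell-dpow zero i bound n (suc k) y _ (inj₂ n<) = trans (+-identityʳ 0#) (sym
    (dpow-vanishesBelow (dropBelow-vanishesBelow (suc i) y) (suc k) n
      (≡.subst (n <_) (≡.trans (ℕ.+-identityʳ _) (ℕ.*-comm (suc k) (suc i))) n<)))
  partialBell-dpow (suc L) i bound n k y k≤bound longEnough = begin
    partialBell i (suc L) bound n k y ≈⟨ partialBell-suc i L bound n k y ⟩
    Σ< (suc bound) blockSum            ≈⟨ Σ<-truncate (suc bound) (suc k) (s≤s k≤bound) tooMany ⟩
    Σ< (suc k) blockSum                ≈⟨ Σ<-cong (suc k) block ⟩
    Σ< (suc k) (λ a → (n C (s ℕ.* a)) × ((equipartitions i a × (y s ^ a)) * rest a)) ≈⟨ dpow-dropBelow i y k n ⟨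
    dpow k (dropBelow s y) n           ∎
    where
    s = suc i
    blockSum : ℕ → Carrier
    blockSum a = sumR (map (λ α → bellTerm i n k y (a ∷ α)) (allVecs L bound))
    rest : ℕ → Carrier
    rest a = dpow (k ∸ a) (dropBelow (suc s) y) (n ∸ s ℕ.* a)
    tooMany : ∀ a → suc k ≤ a → a < suc bound → blockSum a ≈ 0#
    tooMany a k<a _ = sumR-zero (allVecs L bound) (λ α → bellTerm-∷-zero i n k y a α (inj₁ (ℕ.<⇒≱ k<a)))
    block : ∀ a → a < suc k → blockSum a ≈ (n C (s ℕ.* a)) × ((equipartitions i a × (y s ^ a)) * rest a)
    block a (s≤s a≤k) with ℕ.≤-<-connex (s ℕ.* a) n
    ... | inj₂ n<sa rewrite k>n⇒nCk≡0 n<sa =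
      sumR-zero (allVecs L bound) (λ α → bellTerm-∷-zero i n k y a α (inj₂ (ℕ.<⇒≱ n<sa)))
    ... | inj₁ sa≤n = begin
      blockSum a
        ≈⟨ sumR-cong (allVecs L bound) (λ α → bellTerm-∷ i n k y a α a≤k sa≤n) ⟩
      sumR (map (λ α → c * bellTerm s (n ∸ s ℕ.* a) (k ∸ a) y α) (allVecs L bound))
        ≈⟨ sumR-*ˡ c _ (allVecs L bound) ⟩
      c * partialBell s L bound (n ∸ s ℕ.* a) (k ∸ a) y
        ≈⟨ *-congˡ (partialBell-dpow L s bound (n ∸ s ℕ.* a) (k ∸ a) y
                     (ℕ.≤-trans (ℕ.m∸n≤m k a) k≤bound) (longEnough-step a≤k sa≤n longEnough)) ⟩
      c * rest a
        ≈⟨ ×-assoc-* (n C (s ℕ.* a)) _ (rest a) ⟩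
      (n C (s ℕ.* a)) × ((equipartitions i a × (y s ^ a)) * rest a) ∎
      where
      c = (n C (s ℕ.* a)) × (equipartitions i a × (y s ^ a))

  B≈dpow : ∀ n k y → B n k y ≈ dpow k (dropBelow 1 y) n
  B≈dpow n k y = trans (B≈partialBell n k y)
    (partialBell-dpow (suc (n ∸ k)) 0 (n ℕ.+ k) n k y (ℕ.m≤n+m k n) (longEnough-initial n k))

module IncreasingTrees where
  open import Data.Nat using (suc; _≤_)
  open import Data.Nat.Properties using (_≟_; ≤-refl; ≤-trans; n≤1+n; <⇒≱; <-irrefl)
  open import Data.Fin using (Fin; toℕ)
  open import Data.Fin.Properties using (toℕ<n)
  open import Data.Empty using (⊥-elim)
  open import Relation.Nullary using (yes; no)
  open import Relation.Binary.PropositionalEquality using (_≡_; _≢_; refl; sym; trans)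

  outdeg-≥ : ∀ {n} (T : IncTree n) v → n ≤ v → outdeg T v ≡ 0
  outdeg-≥ single v _ = refl
  outdeg-≥ (attach {n} t p) v n≤v with toℕ p ≟ v
  ... | yes refl = ⊥-elim (<⇒≱ (≤-trans (toℕ<n p) (n≤1+n (suc n))) n≤v)
  ... | no _ = outdeg-≥ t v (≤-trans (n≤1+n (suc n)) n≤v)

  outdeg-attach-≡ : ∀ {n} (t : IncTree (suc n)) p → outdeg (attach t p) (toℕ p) ≡ suc (outdeg t (toℕ p))
  outdeg-attach-≡ t p with toℕ p ≟ toℕ p
  ... | yes _ = refl
  ... | no p≢p = ⊥-elim (p≢p refl)

  outdeg-attach-≢ : ∀ {n} (t : IncTree (suc n)) p v → v ≢ toℕ p → outdeg (attach t p) v ≡ outdeg t v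
  outdeg-attach-≢ t p v v≢p with toℕ p ≟ v
  ... | yes p≡v = ⊥-elim (v≢p (sym p≡v))
  ... | no _ = refl

  outdeg-attach-new : ∀ {n} (t : IncTree (suc n)) p → outdeg (attach t p) (suc n) ≡ 0
  outdeg-attach-new {n} t p = trans (outdeg-attach-≢ t p (suc n) (λ n≡p → <-irrefl (sym n≡p) (toℕ<n p)))
                                    (outdeg-≥ t (suc n) ≤-refl)

module TreeSeries {a ℓ} (R : CommutativeRing a ℓ) (x : ℕ → CommutativeRing.Carrier R) where
  open import Data.Nat as ℕ using (ℕ; zero; suc; _<_)
  import Data.Nat.Properties as ℕ
  open import Data.Fin using (toℕ)
  open import Data.List using ([]; _∷_; _++_; map; upTo; allFin)
  import Data.List.Properties as List
  open import Data.Empty using (⊥-elim)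
  open import Function using (_∘_)
  open import Relation.Nullary using (yes; no)
  open import Relation.Binary.PropositionalEquality as ≡ using (_≡_; _≢_)
  open CommutativeRing R hiding (zero)
  open Ops R using (sumR; prodR; p)
  open Sums R
  open HurwitzSeries R
  open IncreasingTrees
  open import Relation.Binary.Reasoning.Setoid setoid

  ∂^ : ℕ → Series → Series
  ∂^ zero f = f
  ∂^ (suc d) f = ∂ (∂^ d f)

  ∂^-at : ∀ d f j → ∂^ d f j ≡ f (d ℕ.+ j)
  ∂^-at zero f j = ≡.refl
  ∂^-at (suc d) f j = ≡.trans (∂^-at d f (suc j)) (≡.cong f (ℕ.+-suc d j))

  Π⋆ : ℕ → (ℕ → Series) → Series
  Π⋆ zero F = one
  Π⋆ (suc m) F = Π⋆ m F ⋆ F m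

  Π⋆-cong : ∀ m {F G : ℕ → Series} → (∀ v → v < m → F v ≋ G v) → Π⋆ m F ≋ Π⋆ m G
  Π⋆-cong zero F≈G j = refl
  Π⋆-cong (suc m) F≈G = ⋆-cong (Π⋆-cong m (λ v v<m → F≈G v (ℕ.m<n⇒m<1+n v<m))) (F≈G m ℕ.≤-refl)

  Π⋆-at-0 : ∀ n (F : ℕ → Series) → prodR (map (λ v → F v 0) (upTo n)) ≈ Π⋆ n F 0
  Π⋆-at-0 zero F = refl
  Π⋆-at-0 (suc n) F = begin
    prodR (map (λ v → F v 0) (upTo (suc n)))            ≡⟨ ≡.cong (λ l → prodR (map (λ v → F v 0) l)) (List.upTo-∷ʳ n) ⟨
    prodR (map (λ v → F v 0) (upTo n ++ n ∷ []))         ≡⟨ ≡.cong prodR (List.map-++ (λ v → F v 0) (upTo n) (n ∷ [])) ⟩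
    prodR (map (λ v → F v 0) (upTo n) ++ F n 0 ∷ [])     ≈⟨ prodR-∷ʳ (map (λ v → F v 0) (upTo n)) (F n 0) ⟩
    prodR (map (λ v → F v 0) (upTo n)) * F n 0          ≈⟨ *-congʳ (Π⋆-at-0 n F) ⟩
    Π⋆ (suc n) F 0                                      ∎

  ∂-Π⋆ : ∀ m (F : ℕ → Series) (FΔ : ℕ → ℕ → Series) →
         (∀ p v → p < m → v < m → v ≢ p → FΔ p v ≋ F v) → (∀ p → p < m → FΔ p p ≋ ∂ (F p)) →
         ∂ (Π⋆ m F) ≋ (λ j → Σ< m (λ p → Π⋆ m (FΔ p) j))
  ∂-Π⋆ zero F FΔ _ _ j = refl
  ∂-Π⋆ (suc m) F FΔ others diagonal j = begin
    (∂ (Π⋆ m F) ⋆ F m) j + (Π⋆ m F ⋆ ∂ (F m)) j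
      ≈⟨ +-congʳ (⋆-cong (∂-Π⋆ m F FΔ (λ p v p<m v<m → others p v (lift p<m) (lift v<m)) (λ p p<m → diagonal p (lift p<m)))
                         (λ _ → refl) j) ⟩
    ((λ i → Σ< m (λ p → Π⋆ m (FΔ p) i)) ⋆ F m) j + (Π⋆ m F ⋆ ∂ (F m)) j
      ≈⟨ +-congʳ (⋆-Σ<ˡ m (λ p → Π⋆ m (FΔ p)) (F m) j) ⟩
    Σ< m (λ p → (Π⋆ m (FΔ p) ⋆ F m) j) + (Π⋆ m F ⋆ ∂ (F m)) j
      ≈⟨ +-cong (Σ<-cong m (λ p p<m → ⋆-cong (λ _ → refl) (λ i → sym (others p m (lift p<m) ℕ.≤-refl (m≢ p<m) i)) j))
                (⋆-cong (λ i → sym (Π⋆-cong m (λ v v<m → others m v ℕ.≤-refl (lift v<m) (m≢ v<m ∘ ≡.sym)) i))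
                        (λ i → sym (diagonal m ℕ.≤-refl i)) j) ⟩
    Σ< (suc m) (λ p → Π⋆ (suc m) (FΔ p) j) ∎
    where
    lift : ∀ {v} → v < m → v < suc m
    lift = ℕ.m<n⇒m<1+n
    m≢ : ∀ {v} → v < m → m ≢ v
    m≢ v<m m≡v = ℕ.<-irrefl (≡.sym m≡v) v<m

  D : Series → Series
  D H = x ⋆ ∂ H

  Dⁿ : ℕ → Series → Series
  Dⁿ zero H = H
  Dⁿ (suc m) H = D (Dⁿ m H)

  D-cong : ∀ {F G} → F ≋ G → D F ≋ D G
  D-cong F≈G = ⋆-cong (λ _ → refl) (λ i → F≈G (suc i))

  Dⁿ-cong : ∀ m {F G} → F ≋ G → Dⁿ m F ≋ Dⁿ m G
  Dⁿ-cong zero F≈G = F≈G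
  Dⁿ-cong (suc m) F≈G = D-cong (Dⁿ-cong m F≈G)

  Dⁿ-suc′ : ∀ m H → Dⁿ (suc m) H ≋ Dⁿ m (D H)
  Dⁿ-suc′ zero H = λ _ → refl
  Dⁿ-suc′ (suc m) H = D-cong (Dⁿ-suc′ m H)

  treeWeight : ∀ {n} → IncTree n → Series
  treeWeight {n} T = Π⋆ n (λ v → ∂^ (outdeg T v) x)

  attachFactor : ∀ {n} → IncTree n → ℕ → ℕ → Series
  attachFactor T p v with v ℕ.≟ p
  ... | yes _ = ∂ (∂^ (outdeg T v) x)
  ... | no _ = ∂^ (outdeg T v) x

  attachFactor-≢ : ∀ {n} (T : IncTree n) p v → v ≢ p → attachFactor T p v ≋ ∂^ (outdeg T v) x
  attachFactor-≢ T p v v≢p with v ℕ.≟ p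
  ... | yes v≡p = ⊥-elim (v≢p v≡p)
  ... | no _ = λ _ → refl

  attachFactor-≡ : ∀ {n} (T : IncTree n) p → attachFactor T p p ≋ ∂ (∂^ (outdeg T p) x)
  attachFactor-≡ T p with p ℕ.≟ p
  ... | yes _ = λ _ → refl
  ... | no p≢p = ⊥-elim (p≢p ≡.refl)

  treeWeight-attach : ∀ {k} (t : IncTree (suc k)) p → treeWeight (attach t p) ≋ Π⋆ (suc k) (attachFactor t (toℕ p)) ⋆ x
  treeWeight-attach {k} t p = ⋆-cong (Π⋆-cong (suc k) factor) newLeaf
    where
    factor : ∀ v → v < suc k → ∂^ (outdeg (attach t p) v) x ≋ attachFactor t (toℕ p) v
    factor v _ with v ℕ.≟ toℕ p
    ... | yes ≡.refl = λ i → reflexive (≡.cong (λ d → ∂^ d x i) (outdeg-attach-≡ t p))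
    ... | no v≢p = λ i → reflexive (≡.cong (λ d → ∂^ d x i) (outdeg-attach-≢ t p v v≢p))
    newLeaf : ∂^ (outdeg (attach t p) (suc k)) x ≋ x
    newLeaf i = reflexive (≡.cong (λ d → ∂^ d x i) (outdeg-attach-new t p))

  D-treeWeight : ∀ {k} (t : IncTree (suc k)) → D (treeWeight t) ≋ (λ j → Σ< (suc k) (λ p → (Π⋆ (suc k) (attachFactor t p) ⋆ x) j))
  D-treeWeight {k} t j = begin
    (x ⋆ ∂ (treeWeight t)) j
      ≈⟨ ⋆-cong (λ _ → refl) (∂-Π⋆ (suc k) _ (attachFactor t) (λ p v _ _ → attachFactor-≢ t p v) (λ p _ → attachFactor-≡ t p)) j ⟩
    (x ⋆ (λ i → Σ< (suc k) (λ p → Π⋆ (suc k) (attachFactor t p) i))) j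
      ≈⟨ ⋆-Σ<ʳ (suc k) (λ p → Π⋆ (suc k) (attachFactor t p)) x j ⟩
    Σ< (suc k) (λ p → (x ⋆ Π⋆ (suc k) (attachFactor t p)) j)
      ≈⟨ Σ<-cong (suc k) (λ p _ → ⋆-comm x _ j) ⟩
    Σ< (suc k) (λ p → (Π⋆ (suc k) (attachFactor t p) ⋆ x) j) ∎

  treeSum : ℕ → Series
  treeSum n j = sumR (map (λ T → treeWeight T j) (allTrees n))

  -- Attaching a new largest leaf below any of the k + 1 vertices is differentiating one factor of the weight.
  treeSum-suc : ∀ k → treeSum (suc (suc k)) ≋ D (treeSum (suc k))
  treeSum-suc k j = begin
    treeSum (suc (suc k)) j
      ≈⟨ sumR-concatMap (λ T → treeWeight T j) (λ t → map (attach t) (allFin (suc k))) (allTrees (suc k)) ⟩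
    sumR (map (λ t → sumR (map (λ T → treeWeight T j) (map (attach t) (allFin (suc k))))) (allTrees (suc k)))
      ≈⟨ sumR-cong (allTrees (suc k)) attachments ⟩
    sumR (map (λ t → (x ⋆ ∂ (treeWeight t)) j) (allTrees (suc k)))
      ≈⟨ ⋆-sumRʳ (allTrees (suc k)) (λ t → ∂ (treeWeight t)) x j ⟨
    D (treeSum (suc k)) j ∎
    where
    attachments : ∀ t → sumR (map (λ T → treeWeight T j) (map (attach t) (allFin (suc k)))) ≈ D (treeWeight t) j
    attachments t = begin
      sumR (map (λ T → treeWeight T j) (map (attach t) (allFin (suc k))))
        ≡⟨ ≡.cong sumR (List.map-∘ (allFin (suc k))) ⟨
      sumR (map (λ p → treeWeight (attach t p) j) (allFin (suc k)))
        ≈⟨ sumR-allFin (suc k) _ _ (λ p → treeWeight-attach t p j) ⟩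
      Σ< (suc k) (λ p → (Π⋆ (suc k) (attachFactor t p) ⋆ x) j)
        ≈⟨ D-treeWeight t j ⟨
      D (treeWeight t) j ∎

  treeSum≈Dⁿx : ∀ k → treeSum (suc k) ≋ Dⁿ k x
  treeSum≈Dⁿx zero j = trans (+-identityʳ _) (⋆-identityˡ x j)
  treeSum≈Dⁿx (suc k) j = trans (treeSum-suc k j) (D-cong (treeSum≈Dⁿx k) j)

  p≈Dⁿx : ∀ k → p x (suc k) ≈ Dⁿ k x 0
  p≈Dⁿx k = trans (sumR-cong (allTrees (suc k)) weightAt0) (treeSum≈Dⁿx k 0)
    where
    weightAt0 : ∀ (T : IncTree (suc k)) → prodR (map (λ v → x (outdeg T v)) (upTo (suc k))) ≈ treeWeight T 0
    weightAt0 T = trans (reflexive (≡.cong prodR (List.map-cong at0 (upTo (suc k))))) (Π⋆-at-0 (suc k) _)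
      where
      at0 : ∀ v → x (outdeg T v) ≡ ∂^ (outdeg T v) x 0
      at0 v = ≡.sym (≡.trans (∂^-at (outdeg T v) x 0) (≡.cong x (ℕ.+-identityʳ _)))

module Inversion {a ℓ} (R : CommutativeRing a ℓ) (x : ℕ → CommutativeRing.Carrier R)
  (x₀⁻¹ : CommutativeRing.Carrier R) (x₀x₀⁻¹≈1 : CommutativeRing._≈_ R (CommutativeRing._*_ R (x 0) x₀⁻¹) (CommutativeRing.1# R)) where
  open import Data.Nat as ℕ using (zero; suc; s≤s; _≤_; _<_; _!)
  import Data.Nat.Properties as ℕ
  open import Data.Nat.Tactic.RingSolver using (solve-∀)
  open import Relation.Binary.PropositionalEquality as ≡ using (_≡_)
  open CommutativeRing R hiding (zero)
  open import Algebra.Properties.Semiring.Mult semiring using (_×_; ×-congʳ; ×-comm-*; ×-assoc-*; ×1-homo-*)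
  open Ops R using (_^_; b; B; shiftArgs; Σ≤)
  open import Algebra.Properties.Ring ring using (-0#≈0#)
  open Sums R
  open HurwitzSeries R
  open BellPolynomials R using (·≡×; B≈dpow)
  open TreeSeries R x
  open IntegerSolver R using (solve; _:+_; _:*_; :-_; _:-_; _:=_)
  open import Relation.Binary.Reasoning.Setoid setoid

  x₀ : Carrier
  x₀ = x 0

  x̃ : Series
  x̃ = dropBelow 1 x

  β : Series
  β = shiftArgs (b x x₀⁻¹)

  weight : ℕ → Carrier
  weight k = (k !) × ((- x₀⁻¹) ^ k)

  ×≈×1#* : ∀ n r → n × r ≈ (n × 1#) * r
  ×≈×1#* n r = sym (trans (×-assoc-* n 1# r) (×-congʳ n (*-identityˡ r)))

  cancel-x₀ : ∀ r → (x₀ * x₀⁻¹) * r ≈ r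
  cancel-x₀ r = trans (*-congʳ x₀x₀⁻¹≈1) (*-identityˡ r)

  x₀-weight-suc : ∀ k → - (x₀ * weight (suc k)) ≈ suc k × weight k
  x₀-weight-suc k = begin
    - (x₀ * ((suc k ℕ.* k !) × (- x₀⁻¹ * P)))       ≈⟨ -‿cong (*-congˡ (trans (×≈×1#* (suc k ℕ.* k !) (- x₀⁻¹ * P)) (*-congʳ (×1-homo-* (suc k) (k !))))) ⟩
    - (x₀ * ((c * f) * (- x₀⁻¹ * P)))                ≈⟨ solve 5 (λ x₀ x₀⁻¹ c f P → :- (x₀ :* ((c :* f) :* (:- x₀⁻¹ :* P))) := (x₀ :* x₀⁻¹) :* (c :* (f :* P))) refl x₀ x₀⁻¹ c f P ⟩
    (x₀ * x₀⁻¹) * (c * (f * P))                      ≈⟨ cancel-x₀ _ ⟩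
    c * (f * P)                                      ≈⟨ trans (×≈×1#* (suc k) (weight k)) (*-congˡ (×≈×1#* (k !) P)) ⟨
    suc k × weight k                                 ∎
    where
    P = (- x₀⁻¹) ^ k
    c = suc k × 1#
    f = (k !) × 1#

  x̃⋆dpow : ∀ k → x̃ ⋆ dpow k x̃ ≋ (λ n → suc k × dpow (suc k) x̃ n)
  x̃⋆dpow k zero = trans (zeroˡ _) (sym (×-zeroʳ (suc k)))
  x̃⋆dpow zero (suc n) = +-congˡ (⋆-zeroʳ x̃ (λ _ → refl) n)
  x̃⋆dpow (suc k) (suc n) = +-congˡ (begin
    (x̃ ⋆ (∂ x̃ ⋆ dpow k x̃)) n                          ≈⟨ ⋆-left-comm x̃ (∂ x̃) (dpow k x̃) n ⟩
    (∂ x̃ ⋆ (x̃ ⋆ dpow k x̃)) n                          ≈⟨ ⋆-cong (λ _ → refl) (x̃⋆dpow k) n ⟩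
    (∂ x̃ ⋆ (λ j → suc k × dpow (suc k) x̃ j)) n         ≈⟨ ⋆-×ʳ (suc k) (∂ x̃) (dpow (suc k) x̃) n ⟩
    suc k × (∂ x̃ ⋆ dpow (suc k) x̃) n                  ∎)

  dpow⋆x : ∀ k n → (dpow k x̃ ⋆ x) n ≈ x₀ * dpow k x̃ n + suc k × dpow (suc k) x̃ n
  dpow⋆x k n = begin
    (dpow k x̃ ⋆ x) n                                    ≈⟨ ⋆-cong (λ _ → refl) (dropBelow-split 0 x) n ⟩
    (dpow k x̃ ⋆ (monomial 0 x₀ ⊕ x̃)) n                   ≈⟨ ⋆-distribˡ-⊕ (dpow k x̃) (monomial 0 x₀) x̃ n ⟩
    (dpow k x̃ ⋆ monomial 0 x₀) n + (dpow k x̃ ⋆ x̃) n       ≈⟨ +-cong (trans (⋆-comm _ _ n) (trans (⋆-monomialˡ 0 x₀ (dpow k x̃) n) (+-identityʳ _)))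
                                                                   (trans (⋆-comm _ _ n) (x̃⋆dpow k n)) ⟩
    x₀ * dpow k x̃ n + suc k × dpow (suc k) x̃ n          ∎

  weighted-dpow⋆x : ∀ k n → weight k * (dpow k x̃ ⋆ x) n ≈
                    x₀ * (weight k * dpow k x̃ n - weight (suc k) * dpow (suc k) x̃ n)
  weighted-dpow⋆x k n = begin
    weight k * (dpow k x̃ ⋆ x) n                 ≈⟨ *-congˡ (dpow⋆x k n) ⟩
    weight k * (x₀ * g + suc k × g′)             ≈⟨ distribˡ _ _ _ ⟩
    weight k * (x₀ * g) + weight k * (suc k × g′) ≈⟨ +-congˡ (trans (×-comm-* (suc k) _ g′) (sym (×-assoc-* (suc k) _ g′))) ⟩
    weight k * (x₀ * g) + (suc k × weight k) * g′ ≈⟨ +-congˡ (*-congʳ (x₀-weight-suc k)) ⟨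
    weight k * (x₀ * g) + (- (x₀ * weight (suc k))) * g′
                                                 ≈⟨ solve 5 (λ x₀ w g w′ g′ → w :* (x₀ :* g) :+ (:- (x₀ :* w′)) :* g′ := x₀ :* (w :* g :- w′ :* g′)) refl x₀ (weight k) g (weight (suc k)) g′ ⟩
    x₀ * (weight k * g - weight (suc k) * g′)    ∎
    where
    g = dpow k x̃ n
    g′ = dpow (suc k) x̃ n

  dpow-x̃-vanishes : ∀ k {n} → n < k → dpow k x̃ n ≈ 0#
  dpow-x̃-vanishes k {n} n<k =
    dpow-vanishesBelow (dropBelow-vanishesBelow 1 x) k n (≡.subst (n <_) (≡.sym (ℕ.*-identityˡ k)) n<k)

  b≈Σ-dpow : ∀ N s → s ≤ N → b x x₀⁻¹ s ≈ x₀⁻¹ * Σ< (suc N) (λ k → weight k * dpow k x̃ s)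
  b≈Σ-dpow N s s≤N = *-congˡ (begin
    Σ≤ s (λ k → ((k !) · ((- x₀⁻¹) ^ k)) * B s k x)     ≈⟨ Σ≤≈Σ< s _ ⟩
    Σ< (suc s) (λ k → ((k !) · ((- x₀⁻¹) ^ k)) * B s k x) ≈⟨ Σ<-cong (suc s) (λ k _ → *-cong (reflexive (·≡× (k !) _)) (B≈dpow s k x)) ⟩
    Σ< (suc s) (λ k → weight k * dpow k x̃ s)            ≈⟨ Σ<-truncate (suc N) (suc s) (s≤s s≤N) beyond ⟨
    Σ< (suc N) (λ k → weight k * dpow k x̃ s)            ∎)
    where
    open Ops R using (_·_)
    beyond : ∀ k → suc s ≤ k → k < suc N → weight k * dpow k x̃ s ≈ 0#
    beyond k s<k _ = trans (*-congˡ (dpow-x̃-vanishes k s<k)) (zeroʳ _)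

  b⋆x≈one : b x x₀⁻¹ ⋆ x ≋ one
  b⋆x≈one n = begin
    (b x x₀⁻¹ ⋆ x) n
      ≈⟨ ⋆-cong-≤ n (λ j j≤n → b≈Σ-dpow n j j≤n) (λ _ _ → refl) ⟩
    (scale x₀⁻¹ (λ j → Σ< (suc n) (λ k → scale (weight k) (dpow k x̃) j)) ⋆ x) n
      ≈⟨ scale-⋆ x₀⁻¹ _ x n ⟩
    x₀⁻¹ * ((λ j → Σ< (suc n) (λ k → scale (weight k) (dpow k x̃) j)) ⋆ x) n
      ≈⟨ *-congˡ (⋆-Σ<ˡ (suc n) (λ k → scale (weight k) (dpow k x̃)) x n) ⟩
    x₀⁻¹ * Σ< (suc n) (λ k → (scale (weight k) (dpow k x̃) ⋆ x) n)
      ≈⟨ *-congˡ (Σ<-cong (suc n) (λ k _ → trans (scale-⋆ (weight k) (dpow k x̃) x n) (weighted-dpow⋆x k n))) ⟩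
    x₀⁻¹ * Σ< (suc n) (λ k → x₀ * (u k - u (suc k)))
      ≈⟨ *-congˡ (Σ<-*ˡ (suc n) x₀ _) ⟨
    x₀⁻¹ * (x₀ * Σ< (suc n) (λ k → u k - u (suc k)))
      ≈⟨ *-congˡ (*-congˡ (Σ<-telescope (suc n) u)) ⟩
    x₀⁻¹ * (x₀ * (u 0 - u (suc n)))
      ≈⟨ *-congˡ (*-congˡ (trans (+-congˡ (-‿cong (trans (*-congˡ (dpow-x̃-vanishes (suc n) ℕ.≤-refl)) (zeroʳ _))))
                                  (trans (+-congˡ -0#≈0#) (+-identityʳ _)))) ⟩
    x₀⁻¹ * (x₀ * u 0)
      ≈⟨ solve 3 (λ x₀⁻¹ x₀ u → x₀⁻¹ :* (x₀ :* u) := (x₀ :* x₀⁻¹) :* u) refl x₀⁻¹ x₀ (u 0) ⟩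
    (x₀ * x₀⁻¹) * u 0
      ≈⟨ cancel-x₀ (u 0) ⟩
    (1# + 0#) * one n
      ≈⟨ trans (*-congʳ (+-identityʳ 1#)) (*-identityˡ _) ⟩
    one n ∎
    where
    u : ℕ → Carrier
    u k = weight k * dpow k x̃ n

  G : ℕ → Series
  G k = dpow k β

  β-vanishesBelow : VanishesBelow 2 β
  β-vanishesBelow zero _ = refl
  β-vanishesBelow (suc zero) _ = refl
  β-vanishesBelow (suc (suc j)) (s≤s (s≤s ()))

  G-vanishesBelow : ∀ k → VanishesBelow (2 ℕ.* k) (G k)
  G-vanishesBelow = dpow-vanishesBelow β-vanishesBelow

  B-β≈G : ∀ n k → B n k β ≈ G k n
  B-β≈G n k = trans (B≈dpow n k β) (dpow-cong k dropBelow-β n)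
    where
    dropBelow-β : dropBelow 1 β ≋ β
    dropBelow-β zero = refl
    dropBelow-β (suc j) = refl

  b-split : b x x₀⁻¹ ≋ monomial 0 x₀⁻¹ ⊕ ∂ β
  b-split zero = begin
    b x x₀⁻¹ 0                      ≈⟨ b≈Σ-dpow 0 0 ℕ.z≤n ⟩
    x₀⁻¹ * (0# + (1# + 0#) * 1#)     ≈⟨ *-congˡ (trans (+-identityˡ _) (trans (*-identityʳ _) (+-identityʳ 1#))) ⟩
    x₀⁻¹ * 1#                        ≈⟨ *-identityʳ x₀⁻¹ ⟩
    x₀⁻¹                             ≈⟨ +-identityʳ x₀⁻¹ ⟨
    x₀⁻¹ + 0#                        ∎
  b-split (suc j) = sym (+-identityˡ _)

  b⋆ : ∀ F → b x x₀⁻¹ ⋆ F ≋ scale x₀⁻¹ F ⊕ ∂ β ⋆ F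
  b⋆ F j = trans (⋆-cong b-split (λ _ → refl) j)
                 (trans (⋆-distribʳ-⊕ (monomial 0 x₀⁻¹) (∂ β) F j) (+-congʳ (trans (⋆-monomialˡ 0 x₀⁻¹ F j) (+-identityʳ _))))

  b⋆D : ∀ H → b x x₀⁻¹ ⋆ D H ≋ ∂ H
  b⋆D H j = trans (sym (⋆-assoc (b x x₀⁻¹) x (∂ H) j)) (trans (⋆-cong b⋆x≈one (λ _ → refl) j) (⋆-identityˡ (∂ H) j))

  lagrangeSum : ℕ → Series → Carrier
  lagrangeSum m F = Σ< (suc m) (λ k → ((- x₀) ^ k) * (G k ⋆ F) (m ℕ.+ k))

  lagrangeSum-cong : ∀ m {F F′} → F ≋ F′ → lagrangeSum m F ≈ lagrangeSum m F′
  lagrangeSum-cong m F≈F′ = Σ<-cong (suc m) (λ k _ → *-congˡ (⋆-cong (λ _ → refl) F≈F′ (m ℕ.+ k)))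

  lagrangeSum-∂ : ∀ m F → lagrangeSum m (∂ F) ≈ x₀ * lagrangeSum (suc m) (b x x₀⁻¹ ⋆ F)
  lagrangeSum-∂ m F = sym (begin
    x₀ * lagrangeSum (suc m) (b x x₀⁻¹ ⋆ F)
      ≈⟨ Σ<-*ˡ (suc (suc m)) x₀ _ ⟩
    Σ< (suc (suc m)) (λ k → x₀ * (((- x₀) ^ k) * (G k ⋆ (b x x₀⁻¹ ⋆ F)) (suc m ℕ.+ k)))
      ≈⟨ Σ<-cong (suc (suc m)) (λ k _ → term k) ⟩
    Σ< (suc (suc m)) (λ k → ∂F-part k + (∂G-part k - ∂G-part (suc k)))
      ≈⟨ Σ<-+ (suc (suc m)) ∂F-part _ ⟩
    (lagrangeSum m (∂ F) + ∂F-part (suc m)) + Σ< (suc (suc m)) (λ k → ∂G-part k - ∂G-part (suc k))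
      ≈⟨ +-cong (+-congˡ ∂F-part-last) (Σ<-telescope (suc (suc m)) ∂G-part) ⟩
    (lagrangeSum m (∂ F) + 0#) + (∂G-part 0 - ∂G-part (suc (suc m)))
      ≈⟨ +-cong (+-identityʳ _) (trans (+-cong ∂G-part-first (-‿cong ∂G-part-last)) (trans (+-congˡ -0#≈0#) (+-identityʳ 0#))) ⟩
    lagrangeSum m (∂ F) + 0#
      ≈⟨ +-identityʳ _ ⟩
    lagrangeSum m (∂ F) ∎)
    where
    ∂G-part ∂F-part : ℕ → Carrier
    ∂G-part k = ((- x₀) ^ k) * (∂ (G k) ⋆ F) (m ℕ.+ k)
    ∂F-part k = ((- x₀) ^ k) * (G k ⋆ ∂ F) (m ℕ.+ k)

    -- Since ∂ (G (k + 1)) = ∂ β ⋆ G k, the ∂ β part of b in the k-th summand cancels against the (k + 1)-st.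
    term : ∀ k → x₀ * (((- x₀) ^ k) * (G k ⋆ (b x x₀⁻¹ ⋆ F)) (suc m ℕ.+ k)) ≈ ∂F-part k + (∂G-part k - ∂G-part (suc k))
    term k = begin
      x₀ * (s * (G k ⋆ (b x x₀⁻¹ ⋆ F)) (suc N))
        ≈⟨ *-congˡ (*-congˡ (trans (⋆-cong (λ _ → refl) (b⋆ F) (suc N)) (⋆-distribˡ-⊕ (G k) (scale x₀⁻¹ F) (∂ β ⋆ F) (suc N)))) ⟩
      x₀ * (s * ((G k ⋆ scale x₀⁻¹ F) (suc N) + (G k ⋆ (∂ β ⋆ F)) (suc N)))
        ≈⟨ *-congˡ (*-congˡ (+-cong (⋆-scale x₀⁻¹ (G k) F (suc N))
                                    (trans (sym (⋆-assoc (G k) (∂ β) F (suc N))) (⋆-cong (⋆-comm (G k) (∂ β)) (λ _ → refl) (suc N))))) ⟩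
      x₀ * (s * (x₀⁻¹ * ((∂ (G k) ⋆ F) N + (G k ⋆ ∂ F) N) + (∂ (G (suc k)) ⋆ F) (suc N)))
        ≈⟨ solve 6 (λ x₀ x₀⁻¹ s g f e → x₀ :* (s :* (x₀⁻¹ :* (g :+ f) :+ e)) := (x₀ :* x₀⁻¹) :* (s :* g :+ s :* f) :+ x₀ :* (s :* e))
                   refl x₀ x₀⁻¹ s ((∂ (G k) ⋆ F) N) ((G k ⋆ ∂ F) N) ((∂ (G (suc k)) ⋆ F) (suc N)) ⟩
      (x₀ * x₀⁻¹) * (s * (∂ (G k) ⋆ F) N + s * (G k ⋆ ∂ F) N) + x₀ * (s * (∂ (G (suc k)) ⋆ F) (suc N))
        ≈⟨ +-congʳ (cancel-x₀ _) ⟩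
      (∂G-part k + ∂F-part k) + x₀ * (s * (∂ (G (suc k)) ⋆ F) (suc N))
        ≈⟨ solve 4 (λ x₀ g f e → (g :+ f) :+ x₀ :* e := f :+ (g :- (:- x₀) :* e)) refl x₀ (∂G-part k) (∂F-part k) _ ⟩
      ∂F-part k + (∂G-part k - (- x₀) * (s * (∂ (G (suc k)) ⋆ F) (suc N)))
        ≈⟨ +-congˡ (+-congˡ (-‿cong (trans (sym (*-assoc _ _ _)) (*-congˡ (reflexive (≡.cong (λ n → (∂ (G (suc k)) ⋆ F) n) (≡.sym (ℕ.+-suc m k)))))))) ⟩
      ∂F-part k + (∂G-part k - ∂G-part (suc k)) ∎
      where
      s = (- x₀) ^ k
      N = m ℕ.+ k

    ∂F-part-last : ∂F-part (suc m) ≈ 0#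
    ∂F-part-last = trans (*-congˡ (⋆-vanishesBelowˡ (∂ F) (G-vanishesBelow (suc m)) (m ℕ.+ suc m) (ℕ.≤-reflexive (index m)))) (zeroʳ _)
      where
      index : ∀ m → suc (m ℕ.+ suc m) ≡ 2 ℕ.* suc m
      index = solve-∀

    ∂G-part-first : ∂G-part 0 ≈ 0#
    ∂G-part-first = trans (*-congˡ (⋆-zeroˡ F (λ _ → refl) (m ℕ.+ 0))) (zeroʳ _)

    ∂G-part-last : ∂G-part (suc (suc m)) ≈ 0#
    ∂G-part-last = trans (*-congˡ (⋆-vanishesBelowˡ F (∂-vanishesBelow (G-vanishesBelow (suc (suc m))))
                                                     (m ℕ.+ suc (suc m)) (ℕ.≤-reflexive (index m)))) (zeroʳ _)
      where
      index : ∀ m → suc (m ℕ.+ suc (suc m)) ≡ suc m ℕ.+ (suc (suc m) ℕ.+ 0)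
      index = solve-∀

  Dⁿ-lagrangeSum : ∀ m H → Dⁿ (suc m) H 0 ≈ (x₀ ^ suc m) * lagrangeSum m (∂ H)
  Dⁿ-lagrangeSum zero H = sym (*-cong (*-identityʳ x₀) (trans (+-identityˡ _) (trans (*-identityˡ _) (*-identityˡ _))))
  Dⁿ-lagrangeSum (suc m) H = begin
    Dⁿ (suc (suc m)) H 0                                   ≈⟨ Dⁿ-suc′ (suc m) H 0 ⟩
    Dⁿ (suc m) (D H) 0                                     ≈⟨ Dⁿ-lagrangeSum m (D H) ⟩
    (x₀ ^ suc m) * lagrangeSum m (∂ (D H))                 ≈⟨ *-congˡ (lagrangeSum-∂ m (D H)) ⟩
    (x₀ ^ suc m) * (x₀ * lagrangeSum (suc m) (b x x₀⁻¹ ⋆ D H)) ≈⟨ *-congˡ (*-congˡ (lagrangeSum-cong (suc m) (b⋆D H))) ⟩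
    (x₀ ^ suc m) * (x₀ * lagrangeSum (suc m) (∂ H))        ≈⟨ solve 3 (λ p x₀ l → p :* (x₀ :* l) := (x₀ :* p) :* l) refl _ x₀ _ ⟩
    (x₀ ^ suc (suc m)) * lagrangeSum (suc m) (∂ H)         ∎

  lagrangeSum-one : ∀ m → lagrangeSum m one ≈ Σ≤ (suc m) (λ k → ((- x₀) ^ k) * B (m ℕ.+ k) k β)
  lagrangeSum-one m = sym (begin
    Σ≤ (suc m) f                 ≈⟨ Σ≤≈Σ< (suc m) f ⟩
    Σ< (suc m) f + f (suc m)     ≈⟨ +-cong (Σ<-cong (suc m) (λ k _ → *-congˡ (trans (B-β≈G (m ℕ.+ k) k) (sym (⋆-identityʳ (G k) (m ℕ.+ k))))))
                                           (trans (*-congˡ (trans (B-β≈G (m ℕ.+ suc m) (suc m)) (G-vanishesBelow (suc m) (m ℕ.+ suc m) (ℕ.≤-reflexive (index m))))) (zeroʳ _)) ⟩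
    lagrangeSum m one + 0#       ≈⟨ +-identityʳ _ ⟩
    lagrangeSum m one            ∎)
    where
    f : ℕ → Carrier
    f k = ((- x₀) ^ k) * B (m ℕ.+ k) k β
    index : ∀ m → suc (m ℕ.+ suc m) ≡ 2 ℕ.* suc m
    index = solve-∀

open import Data.Nat using (suc; _∸_; _+_)

theorem3 : ∀ {c ℓ} (R : CommutativeRing c ℓ) (x : ℕ → CommutativeRing.Carrier R)
    (x₀⁻¹ : CommutativeRing.Carrier R) →
    CommutativeRing._≈_ R (CommutativeRing._*_ R (x 0) x₀⁻¹) (CommutativeRing.1# R) →
    (n : ℕ) → 1 Data.Nat.≤ n →
    CommutativeRing._≈_ R (Ops.p R x n)
      (CommutativeRing._*_ R (Ops._^_ R (x 0) n)
        (Ops.Σ≤ R n (λ k → CommutativeRing._*_ R (Ops._^_ R (CommutativeRing.-_ R (x 0)) k)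
          (Ops.B R ((n + k) ∸ 1) k (Ops.shiftArgs R (Ops.b R x x₀⁻¹))))))
theorem3 R x x₀⁻¹ x₀x₀⁻¹≈1 (suc m) _ = begin
  p x (suc m)                       ≈⟨ p≈Dⁿx m ⟩
  Dⁿ m x 0                          ≈⟨ Dⁿ-cong m (λ j → sym (⋆-identityʳ x j)) 0 ⟩
  Dⁿ m (D t) 0                      ≈⟨ Dⁿ-suc′ m t 0 ⟨
  Dⁿ (suc m) t 0                    ≈⟨ Dⁿ-lagrangeSum m t ⟩
  (x₀ ^ suc m) * lagrangeSum m one  ≈⟨ *-congˡ (lagrangeSum-one m) ⟩
  (x₀ ^ suc m) * Σ≤ (suc m) (λ k → ((- x₀) ^ k) * B (m + k) k β) ∎
  where
  open CommutativeRing R using (setoid; sym; *-congˡ; _*_; -_)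
  open Ops R using (p; _^_; Σ≤; B)
  open HurwitzSeries R using (t; one; ⋆-identityʳ)
  open TreeSeries R x using (D; Dⁿ; Dⁿ-cong; Dⁿ-suc′; p≈Dⁿx)
  open Inversion R x x₀⁻¹ x₀x₀⁻¹≈1 using (x₀; β; lagrangeSum; Dⁿ-lagrangeSum; lagrangeSum-one)
  open import Relation.Binary.Reasoning.Setoid setoid
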